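{- For every finite simple graph $G$ all of whose connected components have an even number of vertices, $\chi_{\operatorname{odd}}(G)\leq 3\operatorname{mw}(G)$.
   Context: A graph is odd if every vertex has odd degree (the graph with no vertices counts as odd). A $k$-odd colouring of $G$ is a partition $(V_1,\dots,V_k)$ of $V(G)$ into (possibly empty) parts such that each induced subgraph $G[V_i]$ is odd; $\chi_{\operatorname{odd}}(G)$ is the least $k$ for which a $k$-odd colouring exists. A set $S\subseteq V(G)$ is a module if every vertex outside $S$ is adjacent either to all vertices of $S$ or to none of them. A module partition of $G$ is a partition $(M_1,\dots,M_k)$ of $V(G)$ with at least two non-empty parts, each of which is a module. Its width is the maximum of $k$ and of $\operatorname{mw}(G[M_i])$ over $i\in[k]$. Modular-width is defined recursively: $\operatorname{mw}(K_1)=1$, and for a graph with at least two vertices, $\operatorname{mw}(G)$ is the minimum width of a module partition of $G$. -}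

module Defs where

open import Data.Nat using (ℕ; _≤_; _%_)
open import Data.Bool using (Bool; true; false; _∧_)
open import Data.Fin using (Fin; _≟_)
open import Data.List using (List; length; filterᵇ; allFin)
open import Data.List.Relation.Unary.Unique.Propositional using (Unique)
open import Data.List.Membership.Propositional using (_∈_)
open import Data.Product using (Σ; ∃; _×_; _,_)
open import Function.Bundles using (_⇔_)
open import Relation.Nullary using (¬_)
open import Relation.Nullary.Decidable using (⌊_⌋)
open import Relation.Binary.PropositionalEquality using (_≡_; _≢_)

record Graph (n : ℕ) : Set where
  field
    adj     : Fin n → Fin n → Bool
    adj-sym : ∀ u v → adj u v ≡ adj v u
    irrefl  : ∀ v → adj v v ≡ false
open Graph public

Odd : ℕ → Set
Odd k = k % 2 ≡ 1

Even : ℕ → Set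
Even k = k % 2 ≡ 0

VSet : ℕ → Set
VSet n = Fin n → Bool

data Reach {n : ℕ} (G : Graph n) : Fin n → Fin n → Set where
  here : ∀ {v} → Reach G v v
  step : ∀ {u v w} → adj G u v ≡ true → Reach G v w → Reach G u w

-- The connected component containing v has an even number of vertices:
-- some duplicate-free list enumerates exactly the vertices reachable from v
-- and has even length.
EvenComponentOf : ∀ {n} → Graph n → Fin n → Set
EvenComponentOf {n} G v =
  Σ (List (Fin n)) λ xs → Unique xs × (∀ u → (u ∈ xs) ⇔ Reach G v u) × Even (length xs)

AllComponentsEven : ∀ {n} → Graph n → Set
AllComponentsEven {n} G = ∀ (v : Fin n) → EvenComponentOf G v

sameColour : ∀ {n k} → (Fin n → Fin k) → Fin n → Fin n → Bool
sameColour c u v = ⌊ c u ≟ c v ⌋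

degInClass : ∀ {n k} → Graph n → (Fin n → Fin k) → Fin n → ℕ
degInClass {n} G c v = length (filterᵇ (λ u → sameColour c u v ∧ adj G v u) (allFin n))

-- A k-odd colouring: partition (V_1,…,V_k) (parts = colour classes, possibly
-- empty) such that every induced G[V_i] is odd.
IsOddColouring : ∀ {n k} → Graph n → (Fin n → Fin k) → Set
IsOddColouring G c = ∀ v → Odd (degInClass G c v)

OddColourable : ∀ {n} → Graph n → ℕ → Set
OddColourable {n} G k = Σ (Fin n → Fin k) λ c → IsOddColouring G c

part : ∀ {n k} → VSet n → (Fin n → Fin k) → Fin k → VSet n
part S p i u = S u ∧ ⌊ p u ≟ i ⌋

NonEmpty : ∀ {n} → VSet n → Set
NonEmpty {n} S = Σ (Fin n) λ u → S u ≡ true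

-- M is a module of G[S]: every vertex of S outside M is adjacent to all or to
-- none of M (equivalently: has the same adjacency to any two vertices of M).
IsModuleIn : ∀ {n} → Graph n → VSet n → VSet n → Set
IsModuleIn {n} G S M =
  ∀ (w : Fin n) → S w ≡ true → M w ≡ false →
  ∀ (x y : Fin n) → M x ≡ true → M y ≡ true → adj G w x ≡ adj G w y

-- MWAtMost G m S  means  mw(G[S]) ≤ m  (recursive definition of modular width).
-- A module partition of G[S] into k parts is given by a labelling p : Fin n → Fin k
-- (only its restriction to S matters); parts may be empty but at least two are
-- non-empty.
data MWAtMost {n : ℕ} (G : Graph n) (m : ℕ) : VSet n → Set where
  single : ∀ {S} (v : Fin n) → S v ≡ true → (∀ u → S u ≡ true → u ≡ v) →
           1 ≤ m → MWAtMost G m S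
  split  : ∀ {S} (k : ℕ) → k ≤ m → (p : Fin n → Fin k) →
           (Σ (Fin k) λ i → Σ (Fin k) λ j → i ≢ j × NonEmpty (part S p i) × NonEmpty (part S p j)) →
           (∀ i → IsModuleIn G S (part S p i)) →
           (∀ i → NonEmpty (part S p i) → MWAtMost G m (part S p i)) →
           MWAtMost G m S

ModularWidthAtMost : ∀ {n} → Graph n → ℕ → Set
ModularWidthAtMost G m = MWAtMost G m (λ _ → true)

-- Colour each component C of G separately. C is connected and even, and descending the modular
-- decomposition gives a partition of C into k ≤ m modules M₁, …, M_k separating two vertices of C.
-- In each Mᵢ pick at most two representatives, together of the parity of |Mᵢ|. Their union R is even and
-- connected in the graph of edges between different modules, so by Scott's theorem (a connected graph of
-- even order has an odd colouring) it has an odd colouring with at most |R| ≤ 2k colours. By Gallai's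
-- theorem Mᵢ splits into an odd part, coloured 0, and a part of even degrees, coloured 1 + the Scott
-- colour of a representative. A vertex sees each other module entirely or not at all, so its degree into
-- the other modules in colour 1 + γ has the parity of its representative's degree in the Scott class γ,
-- which is odd, while colour 0 meets every module evenly. This uses 2k + 1 ≤ 3m colours.

module Submission where

open import Defs
open import Algebra.Bundles using (CommutativeMonoid; CommutativeRing)
import Algebra.Properties.CommutativeMonoid.Sum as Sum
open import Data.Bool using (Bool; true; false; _∧_; _∨_; not; _xor_; if_then_else_)
open import Data.Bool.Properties
  using (∧-comm; ∧-assoc; ∧-zeroʳ; ∧-identityʳ; ∧-conicalˡ; ∧-conicalʳ; ∨-identityʳ; ∨-zeroʳ;
         xor-identityʳ; xor-∧-commutativeRing; if-∧; ∧-distribʳ-∨; not-involutive; not-injective; ∧-inverseʳ; xor-assoc; xor-same;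
         ∧-distribˡ-xor; ∧-distribʳ-xor)
  renaming (_≟_ to _≟ᵇ_)
open import Data.Empty using (⊥; ⊥-elim)
open import Data.Fin using (Fin; zero; suc; _≟_; fromℕ<)
open import Data.Fin.Properties using (any?; fromℕ<-injective; fromℕ<-cong)
open import Data.Nat using (ℕ; zero; suc; _+_; _*_; _≤_; _<_; z≤n; s≤s)
import Data.Nat as ℕ
open import Data.Nat.Properties
  using (+-0-commutativeMonoid; +-mono-≤; m≤n⇒m≤1+n; ≤-trans; <-≤-trans; m≤m+n; +-monoʳ-<; <⇒≢; +-cancelˡ-≡; suc-injective;
         *-monoˡ-≤; +-monoˡ-≤; *-comm; module ≤-Reasoning)
open import Data.List using (List; []; _∷_; length; filterᵇ; tabulate)
open import Data.List.Membership.Propositional using (_∈_)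
open import Data.List.Relation.Unary.All using (All; []; _∷_)
open import Data.List.Relation.Unary.AllPairs using ([]; _∷_)
open import Data.List.Relation.Unary.Any using (here; there)
open import Data.List.Relation.Unary.Unique.Propositional using (Unique)
open import Data.Maybe as Maybe using (Maybe; just; nothing; fromMaybe)
open import Data.Product using (Σ; _×_; _,_; proj₁; proj₂)
open import Data.Sum using (_⊎_; inj₁; inj₂)
open import Function using (_∘_)
open import Function.Bundles using (Equivalence)
open import Relation.Nullary using (¬_; Dec; yes; no)
open import Relation.Nullary.Decidable using (⌊_⌋; _×-dec_)
import Relation.Binary.Reasoning.Setoid as SetoidReasoning
open import Relation.Binary.PropositionalEquality
  using (_≡_; _≢_; _≗_; refl; sym; trans; cong; cong₂; subst; module ≡-Reasoning)

variable
  n k : ℕ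
  G : Graph n
  S T : VSet n
  a b c w : Fin n

true≢false : true ≢ false
true≢false ()

xor-trueʳ : ∀ a → a xor true ≡ not a
xor-trueʳ false = refl
xor-trueʳ true = refl

∨-true : ∀ a {b} → a ∨ b ≡ true → a ≡ true ⊎ b ≡ true
∨-true true _ = inj₁ refl
∨-true false b≡true = inj₂ b≡true

∧-swapʳ : ∀ a b c → (a ∧ b) ∧ c ≡ (a ∧ c) ∧ b
∧-swapʳ a b c = trans (∧-assoc a b c) (trans (cong (a ∧_) (∧-comm b c)) (sym (∧-assoc a c b)))

xor-cancelʳ : ∀ a b → (a xor b) xor b ≡ a
xor-cancelʳ a b = trans (xor-assoc a b b) (trans (cong (a xor_) (xor-same b)) (xor-identityʳ a))

xor-cancelˡ : ∀ a b → (a xor b) xor a ≡ b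
xor-cancelˡ false b = xor-identityʳ b
xor-cancelˡ true false = refl
xor-cancelˡ true true = refl

bool-cases : (b : Bool) → b ≡ true ⊎ b ≡ false
bool-cases true = inj₁ refl
bool-cases false = inj₂ refl

bool-ext : ∀ {p q} → (p ≡ true → q ≡ true) → (q ≡ true → p ≡ true) → p ≡ q
bool-ext {false} {false} _ _ = refl
bool-ext {false} {true} _ q⇒p = q⇒p refl
bool-ext {true} p⇒q _ = sym (p⇒q refl)

∧-not-false : ∀ {a b} → a ≡ true → a ∧ not b ≡ false → b ≡ true
∧-not-false {b = true} _ _ = refl
∧-not-false {b = false} refl ()

⌊⌋-true : ∀ {P : Set} (d : Dec P) → P → ⌊ d ⌋ ≡ true
⌊⌋-true (yes _) _ = refl
⌊⌋-true (no ¬p) p = ⊥-elim (¬p p)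

⌊⌋-false : ∀ {P : Set} (d : Dec P) → ¬ P → ⌊ d ⌋ ≡ false
⌊⌋-false (yes p) ¬p = ⊥-elim (¬p p)
⌊⌋-false (no _) _ = refl

⌊⌋-sound : ∀ {P : Set} (d : Dec P) → ⌊ d ⌋ ≡ true → P
⌊⌋-sound (yes p) _ = p

⌊⌋-cong : ∀ {P Q : Set} → (P → Q) → (Q → P) → (d : Dec P) (e : Dec Q) → ⌊ d ⌋ ≡ ⌊ e ⌋
⌊⌋-cong P⇒Q Q⇒P d e = bool-ext (λ dt → ⌊⌋-true e (P⇒Q (⌊⌋-sound d dt))) (λ et → ⌊⌋-true d (Q⇒P (⌊⌋-sound e et)))

⌊suc≟suc⌋ : (v x : Fin n) → ⌊ suc v ≟ suc x ⌋ ≡ ⌊ v ≟ x ⌋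
⌊suc≟suc⌋ v x with v ≟ x
... | yes _ = refl
... | no _ = refl

⌊suc≟suc⌋ℕ : (a b : ℕ) → ⌊ suc a ℕ.≟ suc b ⌋ ≡ ⌊ a ℕ.≟ b ⌋
⌊suc≟suc⌋ℕ a b = ⌊⌋-cong suc-injective (cong suc) (suc a ℕ.≟ suc b) (a ℕ.≟ b)

-- Vertex sets, counting and parity

module FibreSums {c ℓ} (M : CommutativeMonoid c ℓ) where
  open CommutativeMonoid M
    using (Carrier; _≈_; _∙_; ε; ∙-congˡ; identityˡ; identityʳ; setoid) renaming (sym to ≈-sym)
  open Sum M
  open SetoidReasoning setoid

  ∑-⁅⁆ : (v : Fin n) (f : Fin n → Carrier) → sum (λ x → if ⌊ v ≟ x ⌋ then f x else ε) ≈ f v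
  ∑-⁅⁆ {suc n} zero f = begin
    f zero ∙ sum {n} (λ _ → ε)  ≈⟨ ∙-congˡ (sum-replicate-zero n) ⟩
    f zero ∙ ε                  ≈⟨ identityʳ (f zero) ⟩
    f zero                      ∎
  ∑-⁅⁆ {suc n} (suc v) f = begin
    ε ∙ sum (λ x → if ⌊ suc v ≟ suc x ⌋ then f (suc x) else ε)  ≈⟨ identityˡ _ ⟩
    sum (λ x → if ⌊ suc v ≟ suc x ⌋ then f (suc x) else ε)      ≡⟨ sum-cong-≗ (λ x → cong (if_then f (suc x) else ε) (⌊suc≟suc⌋ v x)) ⟩
    sum (λ x → if ⌊ v ≟ x ⌋ then f (suc x) else ε)              ≈⟨ ∑-⁅⁆ v (f ∘ suc) ⟩
    f (suc v)                                                   ∎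

  ∑-fibres : (p : Fin n → Fin k) (f : Fin n → Carrier) →
             sum f ≈ sum (λ j → sum (λ x → if ⌊ p x ≟ j ⌋ then f x else ε))
  ∑-fibres p f = begin
    sum f                                                   ≈⟨ sum-cong-≋ (λ x → ≈-sym (∑-⁅⁆ (p x) (λ _ → f x))) ⟩
    sum (λ x → sum (λ j → if ⌊ p x ≟ j ⌋ then f x else ε))  ≈⟨ ∑-comm (λ x j → if ⌊ p x ≟ j ⌋ then f x else ε) ⟩
    sum (λ j → sum (λ x → if ⌊ p x ≟ j ⌋ then f x else ε))  ∎

module ℕΣ = Sum +-0-commutativeMonoid
module ⊕Σ = Sum (CommutativeRing.+-commutativeMonoid xor-∧-commutativeRing)
module ℕΣ-fibres = FibreSums +-0-commutativeMonoid
module ⊕Σ-fibres = FibreSums (CommutativeRing.+-commutativeMonoid xor-∧-commutativeRing)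

infixr 7 _∩_
infixr 6 _∪_ _∖_
infix 4 _⊆_

_∩_ _∪_ _∖_ : VSet n → VSet n → VSet n
(A ∩ B) x = A x ∧ B x
(A ∪ B) x = A x ∨ B x
(A ∖ B) x = A x ∧ not (B x)

⁅_⁆ : Fin n → VSet n
⁅ v ⁆ x = ⌊ v ≟ x ⌋

fibre : (Fin n → Fin k) → Fin k → VSet n
fibre p j x = ⌊ p x ≟ j ⌋

_⊆_ : VSet n → VSet n → Set
A ⊆ B = ∀ x → A x ≡ true → B x ≡ true

search : (A : VSet n) → NonEmpty A ⊎ (∀ x → A x ≡ false)
search A with any? (λ x → A x ≟ᵇ true)
... | yes found = inj₁ found
... | no none = inj₂ λ x → ¬true (λ e → none (x , e))
  where
  ¬true : ∀ {b} → ¬ b ≡ true → b ≡ false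
  ¬true {false} _ = refl
  ¬true {true} ¬e = ⊥-elim (¬e refl)

∩-⊆ : {A B : VSet n} → B ⊆ A → A ∩ B ≗ B
∩-⊆ {A = A} {B} B⊆A x with B x in Bx
... | true = trans (∧-identityʳ (A x)) (B⊆A x Bx)
... | false = ∧-zeroʳ (A x)

⊆-false : {A B : VSet n} → A ⊆ B → ∀ x → B x ≡ false → A x ≡ false
⊆-false {A = A} A⊆B x Bx with A x in Ax
... | false = refl
... | true with () ← trans (sym (A⊆B x Ax)) Bx

∖-intro : (A B : VSet n) → A a ≡ true → B a ≡ false → (A ∖ B) a ≡ true
∖-intro {a = a} A B Aa Ba = trans (cong₂ (λ s t → s ∧ not t) Aa Ba) refl

∖-nested : {P D S : VSet n} → P ⊆ D → D ⊆ S → S ∖ P ≗ (S ∖ D) ∪ (D ∖ P)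
∖-nested {P = P} {D} {S} P⊆D D⊆S x with D x in Dx
... | true rewrite D⊆S x Dx = refl
... | false rewrite ⊆-false P⊆D x Dx = sym (∨-identityʳ _)

∖-∖ : {K D S : VSet n} → K ⊆ D → D ⊆ S → S ∖ (D ∖ K) ≗ (S ∖ D) ∪ K
∖-∖ {K = K} {D} {S} K⊆D D⊆S x with D x in Dx
... | true rewrite D⊆S x Dx = not-involutive (K x)
... | false rewrite ⊆-false K⊆D x Dx = sym (∨-identityʳ _)

∪-introˡ : (A B : VSet n) → A ⊆ A ∪ B
∪-introˡ A B u Au rewrite Au = refl

∪-introʳ : (A B : VSet n) → B ⊆ A ∪ B
∪-introʳ A B u Bu rewrite Bu = ∨-zeroʳ (A u)

count : VSet n → ℕ
count A = ℕΣ.sum (λ x → if A x then 1 else 0)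

parity : VSet n → Bool
parity = ⊕Σ.sum

count-cong : {A B : VSet n} → A ≗ B → count A ≡ count B
count-cong A≗B = ℕΣ.sum-cong-≗ (cong (if_then 1 else 0) ∘ A≗B)

parity-cong : {A B : VSet n} → A ≗ B → parity A ≡ parity B
parity-cong = ⊕Σ.sum-cong-≗

parity-xor : (A B : VSet n) → parity (λ x → A x xor B x) ≡ parity A xor parity B
parity-xor = ⊕Σ.∑-distrib-+

parity-split : (A B : VSet n) → parity A ≡ parity (A ∩ B) xor parity (A ∖ B)
parity-split A B = trans (parity-cong (λ x → by-cases (A x) (B x))) (parity-xor (A ∩ B) (A ∖ B))
  where
  by-cases : ∀ a b → a ≡ (a ∧ b) xor (a ∧ not b)
  by-cases false _ = refl
  by-cases true false = refl
  by-cases true true = refl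

count-split : (A B : VSet n) → count A ≡ count (A ∩ B) + count (A ∖ B)
count-split A B = trans (ℕΣ.sum-cong-≗ (λ x → by-cases (A x) (B x))) (ℕΣ.∑-distrib-+ (λ x → if (A ∩ B) x then 1 else 0) (λ x → if (A ∖ B) x then 1 else 0))
  where
  by-cases : ∀ a b → (if a then 1 else 0) ≡ (if a ∧ b then 1 else 0) + (if a ∧ not b then 1 else 0)
  by-cases false _ = refl
  by-cases true false = refl
  by-cases true true = refl

parity-empty : {A : VSet n} → (∀ x → A x ≡ false) → parity A ≡ false
parity-empty {n} none = trans (parity-cong none) (⊕Σ.sum-replicate-zero n)

count-empty : {A : VSet n} → (∀ x → A x ≡ false) → count A ≡ 0
count-empty {n} none = trans (count-cong none) (ℕΣ.sum-replicate-zero n)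

if-then-false : ∀ b a → (if b then a else false) ≡ b ∧ a
if-then-false false _ = refl
if-then-false true _ = refl

parity-⁅⁆∩ : (v : Fin n) (A : VSet n) → parity (⁅ v ⁆ ∩ A) ≡ A v
parity-⁅⁆∩ v A = trans (parity-cong (λ x → sym (if-then-false (⁅ v ⁆ x) (A x)))) (⊕Σ-fibres.∑-⁅⁆ v A)

count-⁅⁆∩ : (v : Fin n) (A : VSet n) → count (⁅ v ⁆ ∩ A) ≡ (if A v then 1 else 0)
count-⁅⁆∩ v A = trans (ℕΣ.sum-cong-≗ (λ x → if-∧ (⁅ v ⁆ x))) (ℕΣ-fibres.∑-⁅⁆ v (λ x → if A x then 1 else 0))

∪-disjoint : {A B : VSet n} → (∀ x → A x ∧ B x ≡ false) → (A ∪ B) ∩ A ≗ A × (A ∪ B) ∖ A ≗ B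
∪-disjoint {A = A} {B} disjoint = on-A , off-A
  where
  on-A : ∀ x → (A x ∨ B x) ∧ A x ≡ A x
  on-A x with A x
  ... | true = refl
  ... | false = ∧-zeroʳ (B x)
  off-A : ∀ x → (A x ∨ B x) ∧ not (A x) ≡ B x
  off-A x with A x in Ax
  ... | true = sym (trans (sym (cong (_∧ B x) Ax)) (disjoint x))
  ... | false = ∧-identityʳ (B x)

parity-∪ : {A B : VSet n} → (∀ x → A x ∧ B x ≡ false) → parity (A ∪ B) ≡ parity A xor parity B
parity-∪ {A = A} {B} disjoint =
  trans (parity-split (A ∪ B) A) (cong₂ _xor_ (parity-cong (proj₁ (∪-disjoint disjoint))) (parity-cong (proj₂ (∪-disjoint disjoint))))

count-∪ : {A B : VSet n} → (∀ x → A x ∧ B x ≡ false) → count (A ∪ B) ≡ count A + count B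
count-∪ {A = A} {B} disjoint =
  trans (count-split (A ∪ B) A) (cong₂ _+_ (count-cong (proj₁ (∪-disjoint disjoint))) (count-cong (proj₂ (∪-disjoint disjoint))))

count-⁅⁆ : (v : Fin n) → count ⁅ v ⁆ ≡ 1
count-⁅⁆ v = trans (count-cong (λ x → sym (∧-identityʳ (⁅ v ⁆ x)))) (count-⁅⁆∩ v (λ _ → true))

parity-⁅⁆ : (v : Fin n) → parity ⁅ v ⁆ ≡ true
parity-⁅⁆ v = trans (parity-cong (λ x → sym (∧-identityʳ (⁅ v ⁆ x)))) (parity-⁅⁆∩ v (λ _ → true))

count-remove : (A : VSet n) (v : Fin n) → A v ≡ true → count A ≡ suc (count (A ∖ ⁅ v ⁆))
count-remove A v Av = begin
  count A                                     ≡⟨ count-split A ⁅ v ⁆ ⟩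
  count (A ∩ ⁅ v ⁆) + count (A ∖ ⁅ v ⁆)       ≡⟨ cong (_+ count (A ∖ ⁅ v ⁆)) (count-cong (λ x → ∧-comm (A x) (⁅ v ⁆ x))) ⟩
  count (⁅ v ⁆ ∩ A) + count (A ∖ ⁅ v ⁆)       ≡⟨ cong (_+ count (A ∖ ⁅ v ⁆)) (count-⁅⁆∩ v A) ⟩
  (if A v then 1 else 0) + count (A ∖ ⁅ v ⁆)  ≡⟨ cong (λ b → (if b then 1 else 0) + count (A ∖ ⁅ v ⁆)) Av ⟩
  suc (count (A ∖ ⁅ v ⁆))                     ∎
  where open ≡-Reasoning

count-remove-≤ : (A : VSet n) (v : Fin n) → A v ≡ true → count A ≤ suc k → count (A ∖ ⁅ v ⁆) ≤ k
count-remove-≤ A v Av A≤ with subst (_≤ _) (count-remove A v Av) A≤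
... | s≤s A∖v≤ = A∖v≤

count-pos : (A : VSet n) (v : Fin n) → A v ≡ true → 0 < count A
count-pos A v Av = subst (0 <_) (sym (count-remove A v Av)) (s≤s z≤n)

count-≤ : (A : VSet n) → count A ≤ n
count-≤ {zero} A = z≤n
count-≤ {suc n} A with A zero
... | true = s≤s (count-≤ (A ∘ suc))
... | false = m≤n⇒m≤1+n (count-≤ (A ∘ suc))

parity-∖⁅⁆ : (A : VSet n) (v : Fin n) → parity (A ∖ ⁅ v ⁆) ≡ parity A xor A v
parity-∖⁅⁆ A v = begin
  parity (A ∖ ⁅ v ⁆)                               ≡⟨ sym (xor-cancelˡ (A v) _) ⟩
  (A v xor parity (A ∖ ⁅ v ⁆)) xor A v             ≡⟨ cong (λ b → (b xor parity (A ∖ ⁅ v ⁆)) xor A v) (sym (parity-⁅⁆∩ v A)) ⟩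
  (parity (⁅ v ⁆ ∩ A) xor parity (A ∖ ⁅ v ⁆)) xor A v
      ≡⟨ cong (λ b → (b xor parity (A ∖ ⁅ v ⁆)) xor A v) (parity-cong (λ x → ∧-comm (⁅ v ⁆ x) (A x))) ⟩
  (parity (A ∩ ⁅ v ⁆) xor parity (A ∖ ⁅ v ⁆)) xor A v  ≡⟨ cong (_xor A v) (sym (parity-split A ⁅ v ⁆)) ⟩
  parity A xor A v                                 ∎
  where open ≡-Reasoning

parity-∧ˡ : (b : Bool) (A : VSet n) → parity (λ x → b ∧ A x) ≡ b ∧ parity A
parity-∧ˡ true A = refl
parity-∧ˡ false A = parity-empty {A = λ x → false ∧ A x} (λ _ → refl)

parity-∧ʳ : (A : VSet n) (b : Bool) → parity (λ x → A x ∧ b) ≡ parity A ∧ b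
parity-∧ʳ A b = trans (parity-cong (λ x → ∧-comm (A x) b)) (trans (parity-∧ˡ b A) (∧-comm b (parity A)))

odd⇒nonEmpty : (A : VSet n) → parity A ≡ true → NonEmpty A
odd⇒nonEmpty A odd with search A
... | inj₁ found = found
... | inj₂ none with () ← trans (sym odd) (parity-empty none)

parity-fibres : (p : Fin n → Fin k) (A : VSet n) → parity A ≡ ⊕Σ.sum (λ j → parity (A ∩ fibre p j))
parity-fibres p A = trans (⊕Σ-fibres.∑-fibres p A)
  (⊕Σ.sum-cong-≗ λ j → parity-cong λ x → trans (if-then-false (fibre p j x) (A x)) (∧-comm (fibre p j x) (A x)))

count-fibres : (p : Fin n → Fin k) (A : VSet n) → ℕΣ.sum (λ j → count (A ∩ fibre p j)) ≡ count A
count-fibres p A = sym (trans (ℕΣ-fibres.∑-fibres p (λ x → if A x then 1 else 0))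
  (ℕΣ.sum-cong-≗ λ j → ℕΣ.sum-cong-≗ λ x → by-cases (fibre p j x) (A x)))
  where
  by-cases : ∀ b a → (if b then (if a then 1 else 0) else 0) ≡ (if a ∧ b then 1 else 0)
  by-cases false false = refl
  by-cases false true = refl
  by-cases true a = cong (if_then 1 else 0) (sym (∧-identityʳ a))

sum-≤ : (g : Fin k → ℕ) {c : ℕ} → (∀ j → g j ≤ c) → ℕΣ.sum g ≤ k * c
sum-≤ {zero} g _ = z≤n
sum-≤ {suc k} g g≤c = +-mono-≤ (g≤c zero) (sum-≤ (g ∘ suc) (g≤c ∘ suc))

count-mono : {A B : VSet n} → A ⊆ B → count A ≤ count B
count-mono {zero} _ = z≤n
count-mono {suc n} {A} {B} A⊆B with A zero in A0 | B zero in B0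
... | false | false = count-mono (A⊆B ∘ suc)
... | false | true = m≤n⇒m≤1+n (count-mono (A⊆B ∘ suc))
... | true | true = s≤s (count-mono (A⊆B ∘ suc))
... | true | false with () ← trans (sym (A⊆B zero A0)) B0

count-∖-≤ : (A K : VSet n) → A a ≡ true → K a ≡ true → count A ≤ suc k → count (A ∖ K) ≤ k
count-∖-≤ {a = a} A K Aa Ka A≤ = ≤-trans (count-mono A∖K⊆) (count-remove-≤ A a Aa A≤)
  where
  A∖K⊆ : A ∖ K ⊆ A ∖ ⁅ a ⁆
  A∖K⊆ x A∖Kx with a ≟ x
  ... | yes refl with () ← trans (sym A∖Kx) (trans (cong (λ k → A a ∧ not k) Ka) (∧-zeroʳ (A a)))
  ... | no _ = trans (∧-identityʳ (A x)) (∧-conicalˡ (A x) _ A∖Kx)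

isOdd : ℕ → Bool
isOdd zero = false
isOdd (suc m) = not (isOdd m)

parity≡isOdd-count : (A : VSet n) → parity A ≡ isOdd (count A)
parity≡isOdd-count {zero} A = refl
parity≡isOdd-count {suc n} A with A zero
... | true = cong not (parity≡isOdd-count (A ∘ suc))
... | false = parity≡isOdd-count (A ∘ suc)

isOdd⇒Odd : ∀ m → isOdd m ≡ true → Odd m
isOdd⇒Odd (suc zero) _ = refl
isOdd⇒Odd (suc (suc m)) odd = isOdd⇒Odd m (trans (sym (not-involutive (isOdd m))) odd)

Even⇒¬isOdd : ∀ m → Even m → isOdd m ≡ false
Even⇒¬isOdd zero _ = refl
Even⇒¬isOdd (suc (suc m)) even = trans (not-involutive (isOdd m)) (Even⇒¬isOdd m even)

⁅⁆-refl : (v : Fin n) → ⁅ v ⁆ v ≡ true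
⁅⁆-refl v = ⌊⌋-true (v ≟ v) refl

⁅⁆-sym : (u v : Fin n) → ⁅ u ⁆ v ≡ ⁅ v ⁆ u
⁅⁆-sym u v with u ≟ v
... | yes refl = sym (⁅⁆-refl u)
... | no u≢v = sym (⌊⌋-false (v ≟ u) (u≢v ∘ sym))

⁅⁆-sound : {u v : Fin n} → ⁅ u ⁆ v ≡ true → u ≡ v
⁅⁆-sound {u = u} {v} = ⌊⌋-sound (u ≟ v)

-- Degrees and the handshake lemma

degParity : Graph n → VSet n → Fin n → Bool
degParity G T u = parity (T ∩ adj G u)

OddIn EvenIn : Graph n → VSet n → Set
OddIn G T = ∀ u → T u ≡ true → degParity G T u ≡ true
EvenIn G T = ∀ u → T u ≡ true → degParity G T u ≡ false

degParity-cong : (G : Graph n) {S T : VSet n} → S ≗ T → ∀ u → degParity G S u ≡ degParity G T u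
degParity-cong G S≗T u = parity-cong λ x → cong (_∧ adj G u x) (S≗T x)

symmetric-double-sum : (g : Fin n → Fin n → Bool) → (∀ u x → g u x ≡ g x u) → (∀ u → g u u ≡ false) →
                       ⊕Σ.sum (λ u → ⊕Σ.sum (g u)) ≡ false
symmetric-double-sum {zero} g _ _ = refl
symmetric-double-sum {suc n} g g-sym g-diag = begin
  (g zero zero xor row₀) xor ⊕Σ.sum (λ u → g (suc u) zero xor rest u)
    ≡⟨ cong₂ (λ d s → (d xor row₀) xor s) (g-diag zero) (⊕Σ.∑-distrib-+ (λ u → g (suc u) zero) rest) ⟩
  row₀ xor (⊕Σ.sum (λ u → g (suc u) zero) xor ⊕Σ.sum rest)
    ≡⟨ cong (λ c → row₀ xor (c xor ⊕Σ.sum rest)) (⊕Σ.sum-cong-≗ λ u → g-sym (suc u) zero) ⟩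
  row₀ xor (row₀ xor ⊕Σ.sum rest)
    ≡⟨ sym (xor-assoc row₀ row₀ _) ⟩
  (row₀ xor row₀) xor ⊕Σ.sum rest
    ≡⟨ cong (_xor ⊕Σ.sum rest) (xor-same row₀) ⟩
  ⊕Σ.sum rest
    ≡⟨ symmetric-double-sum (λ u x → g (suc u) (suc x)) (λ u x → g-sym (suc u) (suc x)) (g-diag ∘ suc) ⟩
  false ∎
  where
  open ≡-Reasoning
  row₀ : Bool
  row₀ = ⊕Σ.sum (λ x → g zero (suc x))
  rest : Fin n → Bool
  rest u = ⊕Σ.sum (λ x → g (suc u) (suc x))

handshake : (G : Graph n) (T : VSet n) → parity (λ u → T u ∧ degParity G T u) ≡ false
handshake G T = trans (parity-cong (λ u → sym (parity-∧ˡ (T u) (T ∩ adj G u))))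
  (symmetric-double-sum (λ u x → T u ∧ (T x ∧ adj G u x)) sym-term diag-term)
  where
  sym-term : ∀ u x → T u ∧ (T x ∧ adj G u x) ≡ T x ∧ (T u ∧ adj G x u)
  sym-term u x rewrite adj-sym G u x with T u | T x
  ... | false | false = refl
  ... | false | true = refl
  ... | true | false = refl
  ... | true | true = refl
  diag-term : ∀ u → T u ∧ (T u ∧ adj G u u) ≡ false
  diag-term u rewrite irrefl G u | ∧-zeroʳ (T u) = ∧-zeroʳ (T u)

oddIn⇒even : (G : Graph n) (T : VSet n) → OddIn G T → parity T ≡ false
oddIn⇒even G T odd = trans (parity-cong T≗oddVertices) (handshake G T)
  where
  T≗oddVertices : ∀ u → T u ≡ (T u ∧ degParity G T u)
  T≗oddVertices u with T u in Tu
  ... | true = sym (odd u Tu)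
  ... | false = refl

-- Gallai's theorem with prescribed parities

localComplement : Graph n → Fin n → Graph n
localComplement G z = record
  { adj = λ a b → adj G a b xor (adj G z a ∧ adj G z b ∧ not (⁅ a ⁆ b))
  ; adj-sym = λ a b → cong₂ _xor_ (adj-sym G a b) (toggle-sym a b)
  ; irrefl = λ a → cong₂ _xor_ (irrefl G a) (trans (cong (λ e → adj G z a ∧ adj G z a ∧ not e) (⁅⁆-refl a))
                                                   (trans (cong (adj G z a ∧_) (∧-zeroʳ (adj G z a))) (∧-zeroʳ (adj G z a))))
  }
  where
  toggle-sym : ∀ a b → adj G z a ∧ adj G z b ∧ not (⁅ a ⁆ b) ≡ adj G z b ∧ adj G z a ∧ not (⁅ b ⁆ a)
  toggle-sym a b rewrite ⁅⁆-sym a b with adj G z a | adj G z b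
  ... | false | false = refl
  ... | false | true = refl
  ... | true | false = refl
  ... | true | true = refl

degParity-localComplement : (G : Graph n) (z : Fin n) (T : VSet n) (u : Fin n) →
  degParity (localComplement G z) T u ≡ degParity G T u xor (adj G z u ∧ (degParity G T z xor T u))
degParity-localComplement G z T u = begin
  degParity (localComplement G z) T u
    ≡⟨ parity-cong (λ x → ∧-distribˡ-xor (T x) (adj G u x) _) ⟩
  parity (λ x → (T ∩ adj G u) x xor (T x ∧ (zu ∧ adj G z x ∧ not (⁅ u ⁆ x))))
    ≡⟨ parity-xor (T ∩ adj G u) _ ⟩
  degParity G T u xor parity (λ x → T x ∧ (zu ∧ adj G z x ∧ not (⁅ u ⁆ x)))
    ≡⟨ cong (degParity G T u xor_) (trans (parity-cong pull-out-zu) (parity-∧ˡ zu ((T ∩ adj G z) ∖ ⁅ u ⁆))) ⟩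
  degParity G T u xor (zu ∧ parity ((T ∩ adj G z) ∖ ⁅ u ⁆))
    ≡⟨ cong (λ t → degParity G T u xor (zu ∧ t)) (parity-∖⁅⁆ (T ∩ adj G z) u) ⟩
  degParity G T u xor (zu ∧ (degParity G T z xor (T u ∧ zu)))
    ≡⟨ cong (degParity G T u xor_) (absorb zu (degParity G T z) (T u)) ⟩
  degParity G T u xor (zu ∧ (degParity G T z xor T u)) ∎
  where
  open ≡-Reasoning
  zu : Bool
  zu = adj G z u
  pull-out-zu : ∀ x → T x ∧ (zu ∧ adj G z x ∧ not (⁅ u ⁆ x)) ≡ zu ∧ ((T ∩ adj G z) ∖ ⁅ u ⁆) x
  pull-out-zu x with zu
  ... | true = sym (∧-assoc (T x) (adj G z x) _)
  ... | false = ∧-zeroʳ (T x)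
  absorb : ∀ e d t → e ∧ (d xor (t ∧ e)) ≡ e ∧ (d xor t)
  absorb false d t = refl
  absorb true d t = cong (λ s → d xor s) (∧-identityʳ t)

degParity-inside-localComplement : (G : Graph n) (z : Fin n) (T : VSet n) (u : Fin n) → T u ≡ true →
  degParity G T u ≡ degParity (localComplement G z) T u xor (adj G z u ∧ not (degParity G T z))
degParity-inside-localComplement G z T u Tu = begin
  degParity G T u                                                           ≡⟨ xor-cancelʳ _ _ ⟨
  (degParity G T u xor (zu ∧ not (degParity G T z))) xor (zu ∧ not (degParity G T z))
    ≡⟨ cong (λ t → (degParity G T u xor (zu ∧ t)) xor (zu ∧ not (degParity G T z))) not-as-xor ⟩
  (degParity G T u xor (zu ∧ (degParity G T z xor T u))) xor (zu ∧ not (degParity G T z))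
    ≡⟨ cong (_xor (zu ∧ not (degParity G T z))) (degParity-localComplement G z T u) ⟨
  degParity (localComplement G z) T u xor (zu ∧ not (degParity G T z))    ∎
  where
  open ≡-Reasoning
  zu : Bool
  zu = adj G z u
  not-as-xor : not (degParity G T z) ≡ degParity G T z xor T u
  not-as-xor = sym (trans (cong (degParity G T z xor_) Tu) (xor-trueʳ (degParity G T z)))

degParity-∪⁅⁆ : (G : Graph n) (T : VSet n) (z u : Fin n) → T z ≡ false →
  degParity G (T ∪ ⁅ z ⁆) u ≡ degParity G T u xor adj G u z
degParity-∪⁅⁆ G T z u Tz = begin
  degParity G (T ∪ ⁅ z ⁆) u
    ≡⟨ parity-cong (λ x → trans (cong (_∧ adj G u x) (∪≗xor x)) (∧-distribʳ-xor (adj G u x) (T x) (⁅ z ⁆ x))) ⟩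
  parity (λ x → (T ∩ adj G u) x xor (⁅ z ⁆ ∩ adj G u) x)
    ≡⟨ parity-xor (T ∩ adj G u) (⁅ z ⁆ ∩ adj G u) ⟩
  degParity G T u xor parity (⁅ z ⁆ ∩ adj G u)
    ≡⟨ cong (degParity G T u xor_) (parity-⁅⁆∩ z (adj G u)) ⟩
  degParity G T u xor adj G u z ∎
  where
  open ≡-Reasoning
  ∪≗xor : ∀ x → T x ∨ ⁅ z ⁆ x ≡ T x xor ⁅ z ⁆ x
  ∪≗xor x with z ≟ x
  ... | yes refl rewrite Tz = refl
  ... | no _ = trans (∨-identityʳ (T x)) (sym (xor-identityʳ (T x)))

degParity-split : (G : Graph n) (T P : VSet n) (u : Fin n) →
  degParity G T u ≡ degParity G (T ∩ P) u xor degParity G (T ∖ P) u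
degParity-split G T P u = trans (parity-split (T ∩ adj G u) P)
  (cong₂ _xor_ (parity-cong λ x → ∧-swapʳ (T x) (adj G u x) (P x))
               (parity-cong λ x → ∧-swapʳ (T x) (adj G u x) (not (P x))))

degParity-∖self : (G : Graph n) (T : VSet n) (u : Fin n) → degParity G (T ∖ ⁅ u ⁆) u ≡ degParity G T u
degParity-∖self G T u = begin
  parity ((T ∖ ⁅ u ⁆) ∩ adj G u)    ≡⟨ parity-cong (λ x → ∧-swapʳ (T x) (not (⁅ u ⁆ x)) (adj G u x)) ⟩
  parity ((T ∩ adj G u) ∖ ⁅ u ⁆)    ≡⟨ parity-∖⁅⁆ (T ∩ adj G u) u ⟩
  degParity G T u xor (T u ∧ adj G u u)  ≡⟨ cong (λ b → degParity G T u xor (T u ∧ b)) (irrefl G u) ⟩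
  degParity G T u xor (T u ∧ false)      ≡⟨ cong (degParity G T u xor_) (∧-zeroʳ (T u)) ⟩
  degParity G T u xor false              ≡⟨ xor-identityʳ _ ⟩
  degParity G T u ∎
  where open ≡-Reasoning

EvenIn-cong : (G : Graph n) {S T : VSet n} → S ≗ T → EvenIn G S → EvenIn G T
EvenIn-cong G S≗T even u Tu = trans (degParity-cong G (sym ∘ S≗T) u) (even u (trans (S≗T u) Tu))

OddIn-cong : (G : Graph n) {S T : VSet n} → S ≗ T → OddIn G S → OddIn G T
OddIn-cong G S≗T odd u Tu = trans (degParity-cong G (sym ∘ S≗T) u) (odd u (trans (S≗T u) Tu))

EvenIn-∩const : (G : Graph n) (A : VSet n) (b : Bool) → EvenIn G A → EvenIn G (λ x → A x ∧ b)
EvenIn-∩const G A true even = EvenIn-cong G (λ x → sym (∧-identityʳ (A x))) even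
EvenIn-∩const G A false _ u A∧false = ⊥-elim (true≢false (trans (sym A∧false) (∧-zeroʳ (A u))))

record ParitySplit (G : Graph n) (S : VSet n) (f : Fin n → Bool) : Set where
  field
    X : VSet n
    X⊆S : X ⊆ S
    X-degrees : ∀ u → X u ≡ true → degParity G X u ≡ f u
    rest-even : EvenIn G (S ∖ X)

-- Gallai's induction: a vertex z of S with the wrong parity is removed, S ∖ z is split in the local
-- complement at z, and z joins whichever side corrects its own parity.
module ParitySplitStep (G : Graph n) (S : VSet n) (f : Fin n → Bool) (z : Fin n) (z∈S : S z ≡ true)
  (z-wrong : degParity G S z ≡ not (f z))
  (split : ParitySplit (localComplement G z) (S ∖ ⁅ z ⁆) (λ u → f u xor (f z ∧ adj G z u))) where

  open ParitySplit split renaming (X to A; X⊆S to A⊆; X-degrees to A-degrees′; rest-even to B-even′)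

  B : VSet n
  B = (S ∖ ⁅ z ⁆) ∖ A

  pa pb : Bool
  pa = degParity G A z
  pb = degParity G B z

  A-z : A z ≡ false
  A-z with A z in Az
  ... | false = refl
  ... | true with () ← trans (sym (∧-conicalʳ (S z) _ (A⊆ z Az))) (cong not (⁅⁆-refl z))

  B-z : B z ≡ false
  B-z = trans (cong (λ e → (S z ∧ not e) ∧ not (A z)) (⁅⁆-refl z)) (cong (_∧ not (A z)) (∧-zeroʳ (S z)))

  pa-xor-pb : pa xor pb ≡ not (f z)
  pa-xor-pb = begin
    pa xor pb                                      ≡⟨ cong (_xor pb) (degParity-cong G A≗ z) ⟩
    degParity G ((S ∖ ⁅ z ⁆) ∩ A) z xor pb         ≡⟨ sym (degParity-split G (S ∖ ⁅ z ⁆) A z) ⟩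
    degParity G (S ∖ ⁅ z ⁆) z                      ≡⟨ degParity-∖self G S z ⟩
    degParity G S z                                ≡⟨ z-wrong ⟩
    not (f z)                                      ∎
    where
    open ≡-Reasoning
    A≗ : A ≗ (S ∖ ⁅ z ⁆) ∩ A
    A≗ x with A x in Ax
    ... | true = sym (trans (∧-identityʳ _) (A⊆ x Ax))
    ... | false = sym (∧-zeroʳ _)

  A-degrees : ∀ u → A u ≡ true → degParity G A u ≡ (f u xor (f z ∧ adj G z u)) xor (adj G z u ∧ not pa)
  A-degrees u Au = trans (degParity-inside-localComplement G z A u Au) (cong (_xor (adj G z u ∧ not pa)) (A-degrees′ u Au))

  B-degrees : ∀ u → B u ≡ true → degParity G B u ≡ adj G z u ∧ not pb
  B-degrees u Bu = trans (degParity-inside-localComplement G z B u Bu) (cong (_xor (adj G z u ∧ not pb)) (B-even′ u Bu))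

  joinX : pb ≡ true → ParitySplit G S f
  joinX pb≡true = record
    { X = A ∪ ⁅ z ⁆
    ; X⊆S = X⊆S
    ; X-degrees = X-degrees
    ; rest-even = EvenIn-cong G rest≗ B-even
    }
    where
    pa≡fz : pa ≡ f z
    pa≡fz = not-injective (trans (sym (trans (cong (pa xor_) pb≡true) (xor-trueʳ pa))) pa-xor-pb)
    X⊆S : A ∪ ⁅ z ⁆ ⊆ S
    X⊆S x inX with ∨-true (A x) inX
    ... | inj₁ Ax = ∧-conicalˡ (S x) _ (A⊆ x Ax)
    ... | inj₂ z≡x = subst (λ y → S y ≡ true) (⁅⁆-sound z≡x) z∈S
    X-degrees : ∀ u → (A ∪ ⁅ z ⁆) u ≡ true → degParity G (A ∪ ⁅ z ⁆) u ≡ f u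
    X-degrees u inX with ∨-true (A u) inX
    ... | inj₂ z≡u rewrite sym (⁅⁆-sound z≡u) = begin
      degParity G (A ∪ ⁅ z ⁆) z     ≡⟨ degParity-∪⁅⁆ G A z z A-z ⟩
      pa xor adj G z z             ≡⟨ cong (pa xor_) (irrefl G z) ⟩
      pa xor false                 ≡⟨ xor-identityʳ pa ⟩
      pa                           ≡⟨ pa≡fz ⟩
      f z                          ∎
      where open ≡-Reasoning
    ... | inj₁ Au = begin
      degParity G (A ∪ ⁅ z ⁆) u                            ≡⟨ degParity-∪⁅⁆ G A z u A-z ⟩
      degParity G A u xor adj G u z                        ≡⟨ cong₂ _xor_ (A-degrees u Au) (adj-sym G u z) ⟩
      ((f u xor (f z ∧ zu)) xor (zu ∧ not pa)) xor zu      ≡⟨ cong (λ p → ((f u xor (f z ∧ zu)) xor (zu ∧ not p)) xor zu) pa≡fz ⟩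
      ((f u xor (f z ∧ zu)) xor (zu ∧ not (f z))) xor zu   ≡⟨ cancel (f u) (f z) zu ⟩
      f u                                                  ∎
      where
      open ≡-Reasoning
      zu : Bool
      zu = adj G z u
      cancel : ∀ x y e → ((x xor (y ∧ e)) xor (e ∧ not y)) xor e ≡ x
      cancel false false false = refl
      cancel false false true = refl
      cancel false true false = refl
      cancel false true true = refl
      cancel true false false = refl
      cancel true false true = refl
      cancel true true false = refl
      cancel true true true = refl
    B-even : EvenIn G B
    B-even u Bu = trans (B-degrees u Bu) (trans (cong (λ p → adj G z u ∧ not p) pb≡true) (∧-zeroʳ (adj G z u)))
    rest≗ : B ≗ S ∖ (A ∪ ⁅ z ⁆)
    rest≗ x = by-cases (S x) (⁅ z ⁆ x) (A x)
      where
      by-cases : ∀ s e a → (s ∧ not e) ∧ not a ≡ s ∧ not (a ∨ e)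
      by-cases false e a = refl
      by-cases true false false = refl
      by-cases true false true = refl
      by-cases true true false = refl
      by-cases true true true = refl

  joinRest : pb ≡ false → ParitySplit G S f
  joinRest pb≡false = record
    { X = A
    ; X⊆S = λ x Ax → ∧-conicalˡ (S x) _ (A⊆ x Ax)
    ; X-degrees = λ u Au → trans (A-degrees u Au)
        (trans (cong (λ p → (f u xor (f z ∧ adj G z u)) xor (adj G z u ∧ not p)) pa≡¬fz) (cancel (f u) (f z) (adj G z u)))
    ; rest-even = EvenIn-cong G rest≗ rest-even
    }
    where
    pa≡¬fz : pa ≡ not (f z)
    pa≡¬fz = trans (sym (trans (cong (pa xor_) pb≡false) (xor-identityʳ pa))) pa-xor-pb
    cancel : ∀ x y a → (x xor (y ∧ a)) xor (a ∧ not (not y)) ≡ x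
    cancel false false false = refl
    cancel false false true = refl
    cancel false true false = refl
    cancel false true true = refl
    cancel true false false = refl
    cancel true false true = refl
    cancel true true false = refl
    cancel true true true = refl
    rest-even : EvenIn G (B ∪ ⁅ z ⁆)
    rest-even u inRest with ∨-true (B u) inRest
    ... | inj₂ z≡u rewrite sym (⁅⁆-sound z≡u) =
      trans (degParity-∪⁅⁆ G B z z B-z) (cong₂ _xor_ pb≡false (irrefl G z))
    ... | inj₁ Bu = begin
      degParity G (B ∪ ⁅ z ⁆) u               ≡⟨ degParity-∪⁅⁆ G B z u B-z ⟩
      degParity G B u xor adj G u z           ≡⟨ cong₂ _xor_ (B-degrees u Bu) (adj-sym G u z) ⟩
      (adj G z u ∧ not pb) xor adj G z u      ≡⟨ cong (λ p → (adj G z u ∧ not p) xor adj G z u) pb≡false ⟩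
      (adj G z u ∧ true) xor adj G z u        ≡⟨ cong (_xor adj G z u) (∧-identityʳ (adj G z u)) ⟩
      adj G z u xor adj G z u                 ≡⟨ xor-same (adj G z u) ⟩
      false                                   ∎
      where open ≡-Reasoning
    rest≗ : B ∪ ⁅ z ⁆ ≗ S ∖ A
    rest≗ x with z ≟ x
    ... | yes refl rewrite z∈S | A-z = refl
    ... | no _ = trans (∨-identityʳ _) (cong (_∧ not (A x)) (∧-identityʳ (S x)))

  extended : ParitySplit G S f
  extended with pb in pb≡
  ... | true = joinX pb≡
  ... | false = joinRest pb≡

paritySplit : ∀ fuel (G : Graph n) (S : VSet n) (f : Fin n → Bool) → count S ≤ fuel → ParitySplit G S f
paritySplit fuel G S f S≤fuel with search (λ z → S z ∧ (degParity G S z xor f z))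
... | inj₂ allRight = record
  { X = S
  ; X⊆S = λ _ Sx → Sx
  ; X-degrees = λ u Su → xor-false (trans (sym (cong (_∧ (degParity G S u xor f u)) Su)) (allRight u))
  ; rest-even = λ u S∖S → ⊥-elim (true≢false (trans (sym S∖S) (∧-inverseʳ (S u))))
  }
  where
  xor-false : ∀ {a b} → a xor b ≡ false → a ≡ b
  xor-false {false} refl = refl
  xor-false {true} {true} _ = refl
... | inj₁ (z , wrong) with fuel
...   | zero with () ← ≤-trans (count-pos S z (∧-conicalˡ (S z) _ wrong)) S≤fuel
...   | suc fuel = ParitySplitStep.extended G S f z (∧-conicalˡ (S z) _ wrong) (xor-true (∧-conicalʳ (S z) _ wrong))
                     (paritySplit fuel (localComplement G z) (S ∖ ⁅ z ⁆) (λ u → f u xor (f z ∧ adj G z u))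
                                  (count-remove-≤ S z (∧-conicalˡ (S z) _ wrong) S≤fuel))
  where
  xor-true : ∀ {a b} → a xor b ≡ true → a ≡ not b
  xor-true {false} refl = refl
  xor-true {true} {false} _ = refl

opaque
  oddEvenSplit : (G : Graph n) (S : VSet n) → ParitySplit G S (λ _ → true)
  oddEvenSplit {n} G S = paritySplit n G S (λ _ → true) (count-≤ S)

-- Paths and components

data Path (G : Graph n) (S : VSet n) : Fin n → Fin n → Set where
  here : ∀ {x} → S x ≡ true → Path G S x x
  step : ∀ {x y z} → S x ≡ true → adj G x y ≡ true → Path G S y z → Path G S x z

Connected : Graph n → VSet n → Set
Connected G S = ∀ x y → S x ≡ true → S y ≡ true → Path G S x y

path-start : Path G S a b → S a ≡ true
path-start (here Sa) = Sa
path-start (step Sa _ _) = Sa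

path-end : Path G S a b → S b ≡ true
path-end (here Sb) = Sb
path-end (step _ _ p) = path-end p

path-mono : S ⊆ T → Path G S a b → Path G T a b
path-mono S⊆T (here Sa) = here (S⊆T _ Sa)
path-mono S⊆T (step Sa e p) = step (S⊆T _ Sa) e (path-mono S⊆T p)

infixr 5 _++_
_++_ : Path G S a b → Path G S b c → Path G S a c
here _ ++ q = q
step Sa e p ++ q = step Sa e (p ++ q)

reverse : Path G S a b → Path G S b a
reverse (here Sa) = here Sa
reverse {G = G} (step {x} {y} Sx e p) = reverse p ++ step (path-start p) (trans (adj-sym G y x) e) (here Sx)

transport-along : {Φ : Fin n → Set} → (∀ {x y} → S x ≡ true → S y ≡ true → adj G x y ≡ true → Φ x → Φ y) →
                  Path G S a b → Φ a → Φ b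
transport-along cross (here _) φ = φ
transport-along cross (step Sa e p) φ = transport-along cross p (cross Sa (path-start p) e φ)

∖⁅⁆-intro : (S : VSet n) → S a ≡ true → w ≢ a → (S ∖ ⁅ w ⁆) a ≡ true
∖⁅⁆-intro {a = a} {w = w} S Sa w≢a = trans (cong₂ (λ s e → s ∧ not e) Sa (⌊⌋-false (w ≟ a) w≢a)) refl

-- Cut the path at its last visit to w.
avoid : Path G S a b → w ≢ b →
        Path G (S ∖ ⁅ w ⁆) a b ⊎ Σ (Fin n) λ z → adj G w z ≡ true × Path G (S ∖ ⁅ w ⁆) z b
avoid {S = S} (here Sb) w≢b = inj₁ (here (∖⁅⁆-intro S Sb w≢b))
avoid {S = S} {w = w} (step {a} {y} Sa e p) w≢b with avoid p w≢b
... | inj₂ later = inj₂ later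
... | inj₁ q with w ≟ a
...   | yes refl = inj₂ (y , e , q)
...   | no w≢a = inj₁ (step (∖⁅⁆-intro S Sa w≢a) e q)

first-step : Path G S w b → w ≢ b → Σ (Fin n) λ z → adj G w z ≡ true × Path G (S ∖ ⁅ w ⁆) z b
first-step {w = w} p w≢b with avoid p w≢b
... | inj₂ found = found
... | inj₁ q with () ← trans (sym (∧-conicalʳ _ _ (path-start q))) (cong not (⁅⁆-refl w))

decPath : ∀ fuel (G : Graph n) (S : VSet n) → count S ≤ fuel → ∀ a b → Dec (Path G S a b)
decPath fuel G S S≤ a b with S a in Sa | a ≟ b
... | false | _ = no λ p → true≢false (trans (sym (path-start p)) Sa)
... | true | yes refl = yes (here Sa)
decPath zero G S S≤ a b | true | no _ with () ← ≤-trans (count-pos S a Sa) S≤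
decPath (suc fuel) G S S≤ a b | true | no a≢b
  with any? (λ z → (adj G a z ≟ᵇ true) ×-dec decPath fuel G (S ∖ ⁅ a ⁆) (count-remove-≤ S a Sa S≤) z b)
... | yes (z , e , p) = yes (step Sa e (path-mono (λ x → ∧-conicalˡ (S x) _) p))
... | no none = no λ p → none (first-step p a≢b)

opaque
  component : Graph n → VSet n → Fin n → VSet n
  component {n} G S w u = ⌊ decPath n G S (count-≤ S) w u ⌋

  component-sound : component G S w a ≡ true → Path G S w a
  component-sound {G = G} {S = S} {w = w} {a = a} = ⌊⌋-sound (decPath _ G S (count-≤ S) w a)

  component-complete : Path G S w a → component G S w a ≡ true
  component-complete {G = G} {S = S} {w = w} {a = a} = ⌊⌋-true (decPath _ G S (count-≤ S) w a)

component-⊆ : component G S w ⊆ S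
component-⊆ a wa = path-end (component-sound wa)

component-self : S w ≡ true → component G S w w ≡ true
component-self Sw = component-complete (here Sw)

within-component : Path G S w a → Path G S a b → Path G (component G S w) a b
within-component q (here Sa) = here (component-complete q)
within-component q (step Sa e p) = step (component-complete q) e (within-component (q ++ step Sa e (here (path-start p))) p)

component-connected : Connected G (component G S w)
component-connected {G = G} {S = S} {w = w} x y wx wy =
  reverse (within-component w⇝w w⇝x) ++ within-component w⇝w (component-sound wy)
  where
  w⇝x : Path G S w x
  w⇝x = component-sound wx
  w⇝w : Path G S w w
  w⇝w = here (path-start w⇝x)

component-same : component G S w a ≡ true → component G S a ≗ component G S w
component-same wa b = bool-ext (λ ab → component-complete (component-sound wa ++ component-sound ab))
                               (λ wb → component-complete (reverse (component-sound wa) ++ component-sound wb))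

component-disjoint : component G S w a ≡ false → component G S a b ≡ true → component G S w b ≡ false
component-disjoint {G = G} {S = S} {w = w} {b = b} ¬wa ab with component G S w b in wb
... | false = refl
... | true with () ← trans (sym (component-complete (component-sound wb ++ reverse (component-sound ab)))) ¬wa

Connected-cong : {A B : VSet n} → A ≗ B → Connected G A → Connected G B
Connected-cong A≗B conn x y Bx By =
  path-mono (λ u Au → trans (sym (A≗B u)) Au) (conn x y (trans (A≗B x) Bx) (trans (A≗B y) By))

Connected-∪ : {A B : VSet n} → Connected G A → Connected G B →
              A a ≡ true → B b ≡ true → adj G a b ≡ true → Connected G (A ∪ B)
Connected-∪ {G = G} {a = a} {b = b} {A} {B} connA connB Aa Bb e x y ABx ABy with ∨-true (A x) ABx | ∨-true (A y) ABy
... | inj₁ Ax | inj₁ Ay = path-mono (∪-introˡ A B) (connA x y Ax Ay)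
... | inj₂ Bx | inj₂ By = path-mono (∪-introʳ A B) (connB x y Bx By)
... | inj₁ Ax | inj₂ By =
  path-mono (∪-introˡ A B) (connA x a Ax Aa) ++ step (∪-introˡ A B a Aa) e (path-mono (∪-introʳ A B) (connB b y Bb By))
... | inj₂ Bx | inj₁ Ay =
  path-mono (∪-introʳ A B) (connB x b Bx Bb) ++ step (∪-introʳ A B b Bb) (trans (adj-sym G b a) e) (path-mono (∪-introˡ A B) (connA a y Aa Ay))

-- Everything outside the removed component still reaches v.
Connected-∖component : {G : Graph n} {S : VSet n} {v w : Fin n} →
                       Connected G S → S v ≡ true → Connected G (S ∖ component G (S ∖ ⁅ v ⁆) w)
Connected-∖component {n} {G} {S} {v} {w} conn Sv x y Tx Ty = to-v x Tx ++ reverse (to-v y Ty)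
  where
  K : VSet n
  K = component G (S ∖ ⁅ v ⁆) w
  Kv : K v ≡ false
  Kv with K v in Kv
  ... | false = refl
  ... | true with () ← trans (sym (∧-conicalʳ (S v) _ (component-⊆ v Kv))) (cong not (⁅⁆-refl v))
  to-v : ∀ z → (S ∖ K) z ≡ true → Path G (S ∖ K) z v
  to-v z Tz with v ≟ z
  ... | yes refl = here Tz
  ... | no v≢z with first-step (conn v z Sv (∧-conicalˡ (S z) _ Tz)) v≢z
  ...   | z′ , e , p = z→z′ ++ step (path-end z→z′) (trans (adj-sym G z′ v) e) (here (trans (cong (S v ∧_) (cong not Kv)) (trans (∧-identityʳ (S v)) Sv)))
    where
    z-side : component G (S ∖ ⁅ v ⁆) z ⊆ S ∖ K
    z-side u zu = trans (cong₂ _∧_ (∧-conicalˡ (S u) _ (component-⊆ u zu))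
                                    (cong not (component-disjoint (not-injective (∧-conicalʳ (S z) _ Tz)) zu))) refl
    z→z′ : Path G (S ∖ K) z z′
    z→z′ = path-mono z-side (within-component (here (path-end p)) (reverse p))

component-∖component : S b ≡ true → component G S w b ≡ false →
                       component G (S ∖ component G S w) b ≗ component G S b
component-∖component {S = S} {b = b} {G = G} {w = w} Sb ¬wb x = bool-ext
  (λ e → component-complete (path-mono (λ u → ∧-conicalˡ (S u) _) (component-sound e)))
  (λ e → component-complete (path-mono stays (within-component (here Sb) (component-sound e))))
  where
  stays : component G S b ⊆ S ∖ component G S w
  stays u bu = trans (cong₂ _∧_ (component-⊆ u bu) (cong not (component-disjoint ¬wb bu))) refl

parity-by-components : ∀ fuel (G : Graph n) (X A B : VSet n) → count X ≤ fuel →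
  (∀ w → X w ≡ true → parity (component G X w ∩ A) ≡ parity (component G X w ∩ B)) →
  parity (X ∩ A) ≡ parity (X ∩ B)
parity-by-components {n} fuel G X A B X≤ same with search X
... | inj₂ empty = trans (parity-empty (λ x → cong (_∧ A x) (empty x))) (sym (parity-empty (λ x → cong (_∧ B x) (empty x))))
... | inj₁ (w , Xw) with fuel
...   | zero with () ← ≤-trans (count-pos X w Xw) X≤
...   | suc fuel = begin
  parity (X ∩ A)                      ≡⟨ by-component A ⟩
  parity (K ∩ A) xor parity (X′ ∩ A)  ≡⟨ cong₂ _xor_ (same w Xw) rest ⟩
  parity (K ∩ B) xor parity (X′ ∩ B)  ≡⟨ sym (by-component B) ⟩
  parity (X ∩ B)                      ∎
  where
  open ≡-Reasoning
  K X′ : VSet n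
  K = component G X w
  X′ = X ∖ K
  by-component : ∀ C → parity (X ∩ C) ≡ parity (K ∩ C) xor parity (X′ ∩ C)
  by-component C = trans (parity-split (X ∩ C) K) (cong₂ _xor_ (parity-cong inK) (parity-cong λ x → ∧-swapʳ (X x) (C x) (not (K x))))
    where
    inK : ∀ x → (X x ∧ C x) ∧ K x ≡ K x ∧ C x
    inK x with K x in Kx
    ... | true = trans (∧-identityʳ _) (cong (_∧ C x) (component-⊆ x Kx))
    ... | false = ∧-zeroʳ _
  components-of-X′ : ∀ w′ → X′ w′ ≡ true → component G X′ w′ ≗ component G X w′
  components-of-X′ w′ X′w′ = component-∖component (∧-conicalˡ (X w′) _ X′w′) (not-injective (∧-conicalʳ (X w′) _ X′w′))
  rest : parity (X′ ∩ A) ≡ parity (X′ ∩ B)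
  rest = parity-by-components fuel G X′ A B (count-∖-≤ X K Xw (component-self Xw) X≤) λ w′ X′w′ →
    trans (parity-cong (λ x → cong (_∧ A x) (components-of-X′ w′ X′w′ x)))
          (trans (same w′ (∧-conicalˡ (X w′) _ X′w′)) (parity-cong (λ x → cong (_∧ B x) (sym (components-of-X′ w′ X′w′ x)))))

-- Scott's theorem

colourIs : (Fin n → ℕ) → ℕ → VSet n
colourIs c t x = ⌊ c x ℕ.≟ t ⌋

classOf : (Fin n → ℕ) → Fin n → VSet n
classOf c u = colourIs c (c u)

IsOddColouringOf : Graph n → VSet n → (Fin n → ℕ) → Set
IsOddColouringOf G S c = ∀ u → S u ≡ true → degParity G (S ∩ classOf c u) u ≡ true

record OddColouring (G : Graph n) (S : VSet n) : Set where
  field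
    colour : Fin n → ℕ
    colour-< : ∀ u → S u ≡ true → colour u < count S
    colour-odd : IsOddColouringOf G S colour

disjointUnion : (P : VSet n) → P ⊆ S → OddColouring G P → OddColouring G (S ∖ P) → OddColouring G S
disjointUnion {n = n} {S = S} {G = G} P P⊆S colP colQ = record
  { colour = colour
  ; colour-< = colour-<
  ; colour-odd = colour-odd
  }
  where
  open OddColouring colP renaming (colour to c₁; colour-< to c₁-<; colour-odd to c₁-odd)
  open OddColouring colQ renaming (colour to c₂; colour-< to c₂-<; colour-odd to c₂-odd)
  colour : Fin n → ℕ
  colour x = if P x then c₁ x else count P + c₂ x
  count-S : count S ≡ count P + count (S ∖ P)
  count-S = trans (count-split S P) (cong (_+ count (S ∖ P)) (count-cong (∩-⊆ P⊆S)))
  colour-< : ∀ u → S u ≡ true → colour u < count S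
  colour-< u Su with P u in Pu
  ... | true = subst (c₁ u <_) (sym count-S) (<-≤-trans (c₁-< u Pu) (m≤m+n (count P) _))
  ... | false = subst (count P + c₂ u <_) (sym count-S) (+-monoʳ-< (count P) (c₂-< u (trans (cong (S u ∧_) (cong not Pu)) (trans (∧-identityʳ (S u)) Su))))
  below≢above : ∀ x y → P x ≡ true → c₁ x ≢ count P + c₂ y
  below≢above x y Px eq = <⇒≢ (<-≤-trans (c₁-< x Px) (m≤m+n (count P) (c₂ y))) eq
  P-class : ∀ u → P u ≡ true → S ∩ classOf colour u ≗ P ∩ classOf c₁ u
  P-class u Pu x with P x in Px
  ... | true rewrite Pu = cong (_∧ ⌊ c₁ x ℕ.≟ c₁ u ⌋) (P⊆S x Px)
  ... | false rewrite Pu = trans (cong (S x ∧_) (⌊⌋-false (count P + c₂ x ℕ.≟ c₁ u) (below≢above u x Pu ∘ sym))) (∧-zeroʳ (S x))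
  Q-class : ∀ u → P u ≡ false → S ∩ classOf colour u ≗ (S ∖ P) ∩ classOf c₂ u
  Q-class u Pu x with P x in Px
  ... | true rewrite Pu = trans (trans (cong (S x ∧_) (⌊⌋-false (c₁ x ℕ.≟ count P + c₂ u) (below≢above x u Px))) (∧-zeroʳ (S x)))
                               (sym (cong (_∧ ⌊ c₂ x ℕ.≟ c₂ u ⌋) (∧-zeroʳ (S x))))
  ... | false rewrite Pu = trans (cong (S x ∧_) (⌊⌋-cong (+-cancelˡ-≡ (count P) _ _) (cong (count P +_)) _ _))
                                 (cong (_∧ ⌊ c₂ x ℕ.≟ c₂ u ⌋) (sym (∧-identityʳ (S x))))
  colour-odd : IsOddColouringOf G S colour
  colour-odd u Su with bool-cases (P u)
  ... | inj₁ Pu = trans (degParity-cong G (P-class u Pu) u) (c₁-odd u Pu)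
  ... | inj₂ Pu = trans (degParity-cong G (Q-class u Pu) u) (c₂-odd u (trans (cong (S u ∧_) (cong not Pu)) (trans (∧-identityʳ (S u)) Su)))

ScottUpTo : ℕ → Graph n → Set
ScottUpTo {n} k G = ∀ (T : VSet n) → count T ≤ k → Connected G T → parity T ≡ false → OddColouring G T

colourBySplitting : ScottUpTo k G → count S ≤ suc k → parity S ≡ false →
  (P : VSet n) → P ⊆ S → Connected G P → Connected G (S ∖ P) → parity P ≡ false →
  P a ≡ true → (S ∖ P) b ≡ true → OddColouring G S
colourBySplitting {k = k} {S = S} {a = a} {b = b} IH S≤ even P P⊆S connP connQ evenP Pa Qb =
  disjointUnion P P⊆S (IH P P≤ connP evenP) (IH (S ∖ P) Q≤ connQ evenQ)
  where
  P≤ : count P ≤ k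
  P≤ = ≤-trans (count-mono P⊆S∖b) (count-remove-≤ S b (∧-conicalˡ (S b) _ Qb) S≤)
    where
    P⊆S∖b : P ⊆ S ∖ ⁅ b ⁆
    P⊆S∖b x Px = ∖⁅⁆-intro S (P⊆S x Px) λ { refl → true≢false (trans (sym Px) (not-injective (∧-conicalʳ (S b) _ Qb))) }
  Q≤ : count (S ∖ P) ≤ k
  Q≤ = count-∖-≤ S P (P⊆S a Pa) Pa S≤
  evenQ : parity (S ∖ P) ≡ false
  evenQ = begin
    parity (S ∖ P)                           ≡⟨⟩
    false xor parity (S ∖ P)                 ≡⟨ cong (_xor parity (S ∖ P)) (sym evenP) ⟩
    parity P xor parity (S ∖ P)              ≡⟨ cong (_xor parity (S ∖ P)) (parity-cong (sym ∘ ∩-⊆ P⊆S)) ⟩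
    parity (S ∩ P) xor parity (S ∖ P)        ≡⟨ sym (parity-split S P) ⟩
    parity S                                 ≡⟨ even ⟩
    false                                    ∎
    where open ≡-Reasoning

-- v has even degree. Split off an even connected piece whose complement stays connected: an even component
-- of S ∖ v if there is one, and otherwise a piece of a component D that meets N(v) evenly.
module ScottStep (G : Graph n) (IH : ScottUpTo k G) (S : VSet n) (S≤ : count S ≤ suc k)
  (conn : Connected G S) (even : parity S ≡ false) (v : Fin n) (Sv : S v ≡ true) (v-even : degParity G S v ≡ false) where

  X : VSet n
  X = S ∖ ⁅ v ⁆

  X⊆S : X ⊆ S
  X⊆S x = ∧-conicalˡ (S x) _

  X-v : X v ≡ false
  X-v = trans (cong (λ e → S v ∧ not e) (⁅⁆-refl v)) (∧-zeroʳ (S v))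

  X-odd : parity X ≡ true
  X-odd = trans (parity-∖⁅⁆ S v) (cong₂ _xor_ even Sv)

  v∈S∖ : {P : VSet n} → P ⊆ X → (S ∖ P) v ≡ true
  v∈S∖ {P} P⊆X = ∖-intro S P Sv (⊆-false P⊆X v X-v)

  viaEvenComponent : ∀ w → X w ≡ true → parity (component G X w) ≡ false → OddColouring G S
  viaEvenComponent w Xw evenK =
    colourBySplitting IH S≤ even (component G X w) (λ x → X⊆S x ∘ component-⊆ x) component-connected
      (Connected-∖component conn Sv) evenK (component-self Xw) (v∈S∖ component-⊆)

  -- Otherwise counting N(v) component by component would give v odd degree.
  attached : (∀ w → X w ≡ true → parity (component G X w) ≡ true) →
             Σ (Fin n) λ u → X u ≡ true × adj G v u ≡ true × parity (component G X u ∩ adj G v) ≡ false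
  attached oddComponents with search (λ u → (X u ∧ adj G v u) ∧ not (parity (component G X u ∩ adj G v)))
  ... | inj₁ (u , found) = u , ∧-conicalˡ (X u) _ X∩Nu , ∧-conicalʳ (X u) _ X∩Nu , not-injective (∧-conicalʳ _ _ found)
    where
    X∩Nu : X u ∧ adj G v u ≡ true
    X∩Nu = ∧-conicalˡ (X u ∧ adj G v u) _ found
  ... | inj₂ none = ⊥-elim (true≢false (trans (sym parity-X) (trans same-parity parity-X∩N)))
    where
    neighbours-odd : ∀ w → X w ≡ true → parity (component G X w ∩ (λ _ → true)) ≡ parity (component G X w ∩ adj G v)
    neighbours-odd w Xw with first-step (conn v w Sv (X⊆S w Xw)) (λ { refl → true≢false (trans (sym Xw) X-v) })
    ... | z , vz , z→w = begin
      parity (component G X w ∩ (λ _ → true))  ≡⟨ parity-cong (λ x → ∧-identityʳ (component G X w x)) ⟩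
      parity (component G X w)                 ≡⟨ oddComponents w Xw ⟩
      true                                     ≡⟨ ∧-not-false (cong₂ _∧_ (path-start z→w) vz) (none z) ⟨
      parity (component G X z ∩ adj G v)       ≡⟨ parity-cong (λ x → cong (_∧ adj G v x) (component-same (component-complete (reverse z→w)) x)) ⟩
      parity (component G X w ∩ adj G v)       ∎
      where open ≡-Reasoning
    same-parity : parity (X ∩ (λ _ → true)) ≡ parity (X ∩ adj G v)
    same-parity = parity-by-components n G X (λ _ → true) (adj G v) (count-≤ X) neighbours-odd
    parity-X : parity (X ∩ (λ _ → true)) ≡ true
    parity-X = trans (parity-cong (λ x → ∧-identityʳ (X x))) X-odd
    parity-X∩N : parity (X ∩ adj G v) ≡ false
    parity-X∩N = trans (degParity-∖self G S v) v-even

  module Attached (u : Fin n) (Xu : X u ≡ true) (vu : adj G v u ≡ true)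
    (even-attachment : parity (component G X u ∩ adj G v) ≡ false) (D-odd : parity (component G X u) ≡ true) where

    D Y : VSet n
    D = component G X u
    Y = D ∖ ⁅ u ⁆

    D⊆S : D ⊆ S
    D⊆S x = X⊆S x ∘ component-⊆ x

    Y⊆D : Y ⊆ D
    Y⊆D x = ∧-conicalˡ (D x) _

    Du : D u ≡ true
    Du = component-self Xu

    S∖D-connected : Connected G (S ∖ D)
    S∖D-connected = Connected-∖component conn Sv

    v∈S∖D : (S ∖ D) v ≡ true
    v∈S∖D = v∈S∖ component-⊆

    second-neighbour : Σ (Fin n) λ y → Y y ≡ true × adj G v y ≡ true
    second-neighbour with odd⇒nonEmpty ((D ∩ adj G v) ∖ ⁅ u ⁆) others-odd
      where
      others-odd : parity ((D ∩ adj G v) ∖ ⁅ u ⁆) ≡ true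
      others-odd = trans (parity-∖⁅⁆ (D ∩ adj G v) u) (cong₂ _xor_ even-attachment (cong₂ _∧_ Du vu))
    ... | y , found = y , cong₂ _∧_ (∧-conicalˡ (D y) _ Dy∧vy) (∧-conicalʳ (D y ∧ adj G v y) _ found) , ∧-conicalʳ (D y) _ Dy∧vy
      where
      Dy∧vy : D y ∧ adj G v y ≡ true
      Dy∧vy = ∧-conicalˡ (D y ∧ adj G v y) _ found

    viaEvenSubcomponent : ∀ w → Y w ≡ true → parity (component G Y w) ≡ false → OddColouring G S
    viaEvenSubcomponent w Yw evenP = colourBySplitting IH S≤ even P P⊆S component-connected rest-connected evenP
      (component-self Yw) (v∈S∖ {P} (λ x → component-⊆ x ∘ Y⊆D x ∘ component-⊆ x))
      where
      P : VSet n
      P = component G Y w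
      P⊆D : P ⊆ D
      P⊆D x = Y⊆D x ∘ component-⊆ x
      P⊆S : P ⊆ S
      P⊆S x = D⊆S x ∘ P⊆D x
      u∈D∖P : (D ∖ P) u ≡ true
      u∈D∖P = ∖-intro D P Du (⊆-false component-⊆ u (trans (cong (λ e → D u ∧ not e) (⁅⁆-refl u)) (∧-zeroʳ (D u))))
      rest-connected : Connected G (S ∖ P)
      rest-connected = Connected-cong (sym ∘ ∖-nested P⊆D D⊆S)
        (Connected-∪ S∖D-connected (Connected-∖component component-connected Du) v∈S∖D u∈D∖P vu)

    viaOddSubcomponents : (∀ w → Y w ≡ true → parity (component G Y w) ≡ true) → OddColouring G S
    viaOddSubcomponents oddSubcomponents = colourBySplitting IH S≤ even P (λ x → D⊆S x ∘ ∧-conicalˡ (D x) _)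
      (Connected-∖component component-connected Du) rest-connected evenP (∖-intro D K Du K-u) (v∈S∖ {P} (λ x → component-⊆ x ∘ ∧-conicalˡ (D x) _))
      where
      y : Fin n
      y = proj₁ second-neighbour
      Yy : Y y ≡ true
      Yy = proj₁ (proj₂ second-neighbour)
      K P : VSet n
      K = component G Y y
      P = D ∖ K
      K⊆D : K ⊆ D
      K⊆D x = Y⊆D x ∘ component-⊆ x
      K-u : K u ≡ false
      K-u = ⊆-false component-⊆ u (trans (cong (λ e → D u ∧ not e) (⁅⁆-refl u)) (∧-zeroʳ (D u)))
      evenP : parity P ≡ false
      evenP = begin
        parity P                             ≡⟨ sym (xor-cancelˡ (parity (D ∩ K)) (parity P)) ⟩
        (parity (D ∩ K) xor parity P) xor parity (D ∩ K)  ≡⟨ cong₂ _xor_ (sym (parity-split D K)) (parity-cong (∩-⊆ K⊆D)) ⟩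
        parity D xor parity K                ≡⟨ cong₂ _xor_ D-odd (oddSubcomponents y Yy) ⟩
        false                                ∎
        where open ≡-Reasoning
      rest-connected : Connected G (S ∖ P)
      rest-connected = Connected-cong (sym ∘ ∖-∖ K⊆D D⊆S)
        (Connected-∪ S∖D-connected component-connected v∈S∖D (component-self Yy) (proj₂ (proj₂ second-neighbour)))

    colouring : OddColouring G S
    colouring with search (λ w → Y w ∧ not (parity (component G Y w)))
    ... | inj₁ (w , found) = viaEvenSubcomponent w (∧-conicalˡ (Y w) _ found) (not-injective (∧-conicalʳ (Y w) _ found))
    ... | inj₂ none = viaOddSubcomponents λ w Yw → ∧-not-false Yw (none w)

  colouring : OddColouring G S
  colouring with search (λ w → X w ∧ not (parity (component G X w)))
  ... | inj₁ (w , found) = viaEvenComponent w (∧-conicalˡ (X w) _ found) (not-injective (∧-conicalʳ (X w) _ found))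
  ... | inj₂ none with attached oddComponents
    where
    oddComponents : ∀ w → X w ≡ true → parity (component G X w) ≡ true
    oddComponents w Xw = ∧-not-false Xw (none w)
  ... | u , Xu , vu , even-attachment = Attached.colouring u Xu vu even-attachment (∧-not-false Xu (none u))

scott : ∀ fuel → ScottUpTo fuel G
scott {G = G} fuel S S≤ conn even with search (λ u → S u ∧ not (degParity G S u))
... | inj₂ allOdd = record
  { colour = λ _ → 0
  ; colour-< = count-pos S
  ; colour-odd = λ u Su → trans (degParity-cong G (λ x → ∧-identityʳ (S x)) u) (∧-not-false Su (allOdd u))
  }
... | inj₁ (v , v-even) with fuel
...   | zero with () ← ≤-trans (count-pos S v (∧-conicalˡ (S v) _ v-even)) S≤
...   | suc fuel = ScottStep.colouring G (scott fuel) S S≤ conn even v (∧-conicalˡ (S v) _ v-even)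
                     (not-injective (∧-conicalʳ (S v) _ v-even))

-- Colouring a single module

-- Colour 1 + γ on M mirrors Scott colour γ on the representatives R.
record LocalColouring (G : Graph n) (M R : VSet n) (cp : Fin n → ℕ) : Set where
  field
    colour : Fin n → ℕ
    zero-odd : OddIn G (M ∩ colourIs colour 0)
    suc-even : ∀ γ → EvenIn G (M ∩ colourIs colour (suc γ))
    suc-parity : ∀ γ → parity (M ∩ colourIs colour (suc γ)) ≡ parity (R ∩ colourIs cp γ)
    suc-rep : ∀ γ u → (M ∩ colourIs colour (suc γ)) u ≡ true → Σ (Fin n) λ ρ → R ρ ≡ true × cp ρ ≡ γ

blockColouring : {M R : VSet n} (cp : Fin n → ℕ) (halves : ParitySplit G M (λ _ → true)) (a : Fin n) → R a ≡ true →
  (∀ γ → parity (R ∩ colourIs cp γ) ≡ parity (M ∖ ParitySplit.X halves) ∧ ⌊ cp a ℕ.≟ γ ⌋) → LocalColouring G M R cp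
blockColouring {n = n} {G = G} {M = M} {R} cp halves a Ra R-parity = record
  { colour = colour
  ; zero-odd = OddIn-cong G (sym ∘ layer-zero) X-degrees
  ; suc-even = λ γ → EvenIn-cong G (sym ∘ layer-suc γ) (EvenIn-∩const G (M ∖ X) _ rest-even)
  ; suc-parity = λ γ → trans (parity-cong (layer-suc γ)) (trans (parity-∧ʳ (M ∖ X) _) (sym (R-parity γ)))
  ; suc-rep = λ γ u inLayer → a , Ra , ⌊⌋-sound (cp a ℕ.≟ γ) (∧-conicalʳ ((M ∖ X) u) _ (trans (sym (layer-suc γ u)) inLayer))
  }
  where
  open ParitySplit halves
  colour : Fin n → ℕ
  colour x = if X x then 0 else suc (cp a)
  layer-zero : M ∩ colourIs colour 0 ≗ X
  layer-zero x with X x in Xx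
  ... | true = trans (∧-identityʳ (M x)) (X⊆S x Xx)
  ... | false = ∧-zeroʳ (M x)
  layer-suc : ∀ γ → M ∩ colourIs colour (suc γ) ≗ (M ∖ X) ∩ (λ _ → ⌊ cp a ℕ.≟ γ ⌋)
  layer-suc γ x with X x
  ... | true = trans (∧-zeroʳ (M x)) (sym (cong (_∧ ⌊ cp a ℕ.≟ γ ⌋) (∧-zeroʳ (M x))))
  ... | false = trans (cong (M x ∧_) (⌊suc≟suc⌋ℕ (cp a) γ)) (cong (_∧ ⌊ cp a ℕ.≟ γ ⌋) (sym (∧-identityʳ (M x))))

LocalColouring-cong : {M M′ R : VSet n} {cp : Fin n → ℕ} → M ≗ M′ → LocalColouring G M R cp → LocalColouring G M′ R cp
LocalColouring-cong {G = G} {M = M} {M′} {R} {cp} M≗M′ L = record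
  { colour = colour
  ; zero-odd = OddIn-cong G (layer≗ 0) zero-odd
  ; suc-even = λ γ → EvenIn-cong G (layer≗ (suc γ)) (suc-even γ)
  ; suc-parity = λ γ → trans (parity-cong (sym ∘ layer≗ (suc γ))) (suc-parity γ)
  ; suc-rep = λ γ u inLayer → suc-rep γ u (trans (layer≗ (suc γ) u) inLayer)
  }
  where
  open LocalColouring L
  layer≗ : ∀ t → M ∩ colourIs colour t ≗ M′ ∩ colourIs colour t
  layer≗ t x = cong (_∧ colourIs colour t x) (M≗M′ x)

-- b forms a layer of its own, coloured 1 + cp b, which no vertex of M uses.
addSingleton : {M R : VSet n} (cp : Fin n → ℕ) (b : Fin n) → M b ≡ false → R ⊆ M →
  (∀ ρ → R ρ ≡ true → cp ρ ≢ cp b) → LocalColouring G M R cp → LocalColouring G (M ∪ ⁅ b ⁆) (R ∪ ⁅ b ⁆) cp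
addSingleton {n = n} {G = G} {M = M} {R} cp b Mb R⊆M unused L = record
  { colour = colour′
  ; zero-odd = OddIn-cong G (sym ∘ layer-zero) zero-odd
  ; suc-even = suc-even′
  ; suc-parity = suc-parity′
  ; suc-rep = suc-rep′
  }
  where
  open LocalColouring L
  M′ : VSet n
  M′ = M ∪ ⁅ b ⁆
  colour′ : Fin n → ℕ
  colour′ x = if ⁅ b ⁆ x then suc (cp b) else colour x
  layer-zero : M′ ∩ colourIs colour′ 0 ≗ M ∩ colourIs colour 0
  layer-zero x with b ≟ x
  ... | yes refl = trans (∧-zeroʳ _) (sym (cong (_∧ colourIs colour 0 b) Mb))
  ... | no _ = cong (_∧ colourIs colour 0 x) (∨-identityʳ (M x))
  layer-suc : ∀ γ → M′ ∩ colourIs colour′ (suc γ) ≗ (M ∩ colourIs colour (suc γ)) ∪ (⁅ b ⁆ ∩ colourIs cp γ)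
  layer-suc γ x with b ≟ x
  ... | yes refl rewrite Mb = ⌊suc≟suc⌋ℕ (cp b) γ
  ... | no _ = trans (cong (_∧ colourIs colour (suc γ) x) (∨-identityʳ (M x))) (sym (∨-identityʳ _))
  apart-from-b : {A : VSet n} → A b ≡ false → ∀ (B C : VSet n) x → (A ∩ B) x ∧ (⁅ b ⁆ ∩ C) x ≡ false
  apart-from-b {A} Ab B C x with b ≟ x
  ... | yes refl rewrite Ab = refl
  ... | no _ = ∧-zeroʳ ((A ∩ B) x)
  b-colour-unused : ∀ x → (M ∩ colourIs colour (suc (cp b))) x ≡ false
  b-colour-unused x with bool-cases ((M ∩ colourIs colour (suc (cp b))) x)
  ... | inj₂ free = free
  ... | inj₁ taken with suc-rep (cp b) x taken
  ...   | ρ , Rρ , ρ-colour = ⊥-elim (unused ρ Rρ ρ-colour)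
  layer-b : M′ ∩ colourIs colour′ (suc (cp b)) ≗ ⁅ b ⁆
  layer-b x = trans (layer-suc (cp b) x) (trans (cong (_∨ (⁅ b ⁆ ∩ colourIs cp (cp b)) x) (b-colour-unused x)) b-on)
    where
    b-on : (⁅ b ⁆ ∩ colourIs cp (cp b)) x ≡ ⁅ b ⁆ x
    b-on with b ≟ x
    ... | yes refl = ⌊⌋-true (cp b ℕ.≟ cp b) refl
    ... | no _ = refl
  layer-other : ∀ γ → cp b ≢ γ → M′ ∩ colourIs colour′ (suc γ) ≗ M ∩ colourIs colour (suc γ)
  layer-other γ b≢γ x = trans (layer-suc γ x) (trans (cong ((M ∩ colourIs colour (suc γ)) x ∨_) b-off) (∨-identityʳ _))
    where
    b-off : (⁅ b ⁆ ∩ colourIs cp γ) x ≡ false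
    b-off with b ≟ x
    ... | yes refl = ⌊⌋-false (cp b ℕ.≟ γ) b≢γ
    ... | no _ = refl
  suc-even′ : ∀ γ → EvenIn G (M′ ∩ colourIs colour′ (suc γ))
  suc-even′ γ u inLayer with cp b ℕ.≟ γ
  ... | no b≢γ = trans (degParity-cong G (layer-other γ b≢γ) u) (suc-even γ u (trans (sym (layer-other γ b≢γ u)) inLayer))
  ... | yes refl with ⁅⁆-sound (trans (sym (layer-b u)) inLayer)
  ...   | refl = trans (degParity-cong G layer-b b) (trans (parity-⁅⁆∩ b (adj G b)) (irrefl G b))
  suc-parity′ : ∀ γ → parity (M′ ∩ colourIs colour′ (suc γ)) ≡ parity ((R ∪ ⁅ b ⁆) ∩ colourIs cp γ)
  suc-parity′ γ = begin
    parity (M′ ∩ colourIs colour′ (suc γ))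
      ≡⟨ parity-cong (layer-suc γ) ⟩
    parity ((M ∩ colourIs colour (suc γ)) ∪ (⁅ b ⁆ ∩ colourIs cp γ))
      ≡⟨ parity-∪ (apart-from-b {A = M} Mb (colourIs colour (suc γ)) (colourIs cp γ)) ⟩
    parity (M ∩ colourIs colour (suc γ)) xor parity (⁅ b ⁆ ∩ colourIs cp γ)
      ≡⟨ cong (_xor parity (⁅ b ⁆ ∩ colourIs cp γ)) (suc-parity γ) ⟩
    parity (R ∩ colourIs cp γ) xor parity (⁅ b ⁆ ∩ colourIs cp γ)
      ≡⟨ parity-∪ (apart-from-b {A = R} (⊆-false R⊆M b Mb) (colourIs cp γ) (colourIs cp γ)) ⟨
    parity ((R ∩ colourIs cp γ) ∪ (⁅ b ⁆ ∩ colourIs cp γ))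
      ≡⟨ parity-cong (λ x → ∧-distribʳ-∨ (colourIs cp γ x) (R x) (⁅ b ⁆ x)) ⟨
    parity ((R ∪ ⁅ b ⁆) ∩ colourIs cp γ) ∎
    where open ≡-Reasoning
  suc-rep′ : ∀ γ u → (M′ ∩ colourIs colour′ (suc γ)) u ≡ true → Σ (Fin n) λ ρ → (R ∪ ⁅ b ⁆) ρ ≡ true × cp ρ ≡ γ
  suc-rep′ γ u inLayer with cp b ℕ.≟ γ
  ... | yes b≡γ = b , ∪-introʳ R ⁅ b ⁆ b (⁅⁆-refl b) , b≡γ
  ... | no b≢γ with suc-rep γ u (trans (sym (layer-other γ b≢γ u)) inLayer)
  ...   | ρ , Rρ , ρ-colour = ρ , ∪-introˡ R ⁅ b ⁆ ρ Rρ , ρ-colour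

parity-∖oddPart : (G : Graph n) {S X : VSet n} → X ⊆ S → OddIn G X → parity (S ∖ X) ≡ parity S
parity-∖oddPart G {S} {X} X⊆S odd = begin
  parity (S ∖ X)                        ≡⟨⟩
  false xor parity (S ∖ X)              ≡⟨ cong (_xor parity (S ∖ X)) (sym (oddIn⇒even G X odd)) ⟩
  parity X xor parity (S ∖ X)           ≡⟨ cong (_xor parity (S ∖ X)) (parity-cong (sym ∘ ∩-⊆ X⊆S)) ⟩
  parity (S ∩ X) xor parity (S ∖ X)     ≡⟨ parity-split S X ⟨
  parity S                              ∎
  where open ≡-Reasoning

∖⁅⁆-∪⁅⁆ : (S : VSet n) → S b ≡ true → (S ∖ ⁅ b ⁆) ∪ ⁅ b ⁆ ≗ S
∖⁅⁆-∪⁅⁆ {b = b} S Sb x with b ≟ x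
... | yes refl = trans (∨-zeroʳ _) (sym Sb)
... | no _ = trans (∨-identityʳ _) (∧-identityʳ (S x))

-- At most two vertices of M, of the parity of M, chosen before the Scott colouring cp of all
-- representatives is known.
record Representatives (G : Graph n) (M : VSet n) : Set where
  field
    reps : VSet n
    reps⊆M : reps ⊆ M
    reps-count : count reps ≤ 2
    reps-parity : parity reps ≡ parity M
    reps-nonEmpty : NonEmpty M → NonEmpty reps
    localColouring : (cp : Fin n → ℕ) → LocalColouring G M reps cp

record OddAnchor (G : Graph n) (M : VSet n) : Set where
  field
    α : Fin n
    α∈M : M α ≡ true
    localColouring : (cp : Fin n → ℕ) → LocalColouring G M ⁅ α ⁆ cp

  ⁅α⁆⊆M : ⁅ α ⁆ ⊆ M
  ⁅α⁆⊆M x α≡x = subst (λ y → M y ≡ true) (⁅⁆-sound α≡x) α∈M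

opaque
  oddAnchor : (G : Graph n) (M : VSet n) → parity M ≡ true → OddAnchor G M
  oddAnchor G M M-odd = record
    { α = proj₁ anchor
    ; α∈M = ∧-conicalˡ (M (proj₁ anchor)) _ (proj₂ anchor)
    ; localColouring = λ cp → blockColouring cp (oddEvenSplit G M) (proj₁ anchor) (⁅⁆-refl (proj₁ anchor))
        λ γ → trans (parity-⁅⁆∩ (proj₁ anchor) (colourIs cp γ)) (cong (_∧ ⌊ cp (proj₁ anchor) ℕ.≟ γ ⌋) (sym rest-odd))
    }
    where
    open ParitySplit (oddEvenSplit G M)
    rest-odd : parity (M ∖ X) ≡ true
    rest-odd = trans (parity-∖oddPart G X⊆S X-degrees) M-odd
    anchor : NonEmpty (M ∖ X)
    anchor = odd⇒nonEmpty (M ∖ X) rest-odd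

oddRepresentatives : (G : Graph n) (M : VSet n) → parity M ≡ true → Representatives G M
oddRepresentatives G M M-odd = record
  { reps = ⁅ α ⁆
  ; reps⊆M = ⁅α⁆⊆M
  ; reps-count = subst (_≤ 2) (sym (count-⁅⁆ α)) (s≤s z≤n)
  ; reps-parity = trans (parity-⁅⁆ α) (sym M-odd)
  ; reps-nonEmpty = λ _ → α , ⁅⁆-refl α
  ; localColouring = localColouring
  }
  where open OddAnchor (oddAnchor G M M-odd)

-- α comes from the odd set M ∖ b. If α and b get different Scott colours, b becomes a layer of its own;
-- otherwise M is coloured as a single block.
evenRepresentatives : (G : Graph n) (M : VSet n) → parity M ≡ false → (b : Fin n) → M b ≡ true → Representatives G M
evenRepresentatives {n = n} G M M-even b Mb = record
  { reps = ⁅ α ⁆ ∪ ⁅ b ⁆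
  ; reps⊆M = reps⊆M
  ; reps-count = subst (_≤ 2) (sym (trans (count-∪ apart) (cong₂ _+_ (count-⁅⁆ α) (count-⁅⁆ b)))) (s≤s (s≤s z≤n))
  ; reps-parity = trans (parity-∪ apart) (trans (cong₂ _xor_ (parity-⁅⁆ α) (parity-⁅⁆ b)) (sym M-even))
  ; reps-nonEmpty = λ _ → b , ∪-introʳ ⁅ α ⁆ ⁅ b ⁆ b (⁅⁆-refl b)
  ; localColouring = localColouring′
  }
  where
  opaque
    M∖b-odd : parity (M ∖ ⁅ b ⁆) ≡ true
    M∖b-odd = trans (parity-∖⁅⁆ M b) (cong₂ _xor_ M-even Mb)
  open OddAnchor (oddAnchor G (M ∖ ⁅ b ⁆) M∖b-odd)
  α≢b : α ≢ b
  α≢b α≡b = true≢false (trans (sym (∧-conicalʳ (M α) _ α∈M)) (cong not (trans (cong ⁅ b ⁆ α≡b) (⁅⁆-refl b))))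
  apart : ∀ x → ⁅ α ⁆ x ∧ ⁅ b ⁆ x ≡ false
  apart x with α ≟ x
  ... | yes refl = ⌊⌋-false (b ≟ α) (α≢b ∘ sym)
  ... | no _ = refl
  apart-∩ : ∀ (C : VSet n) x → (⁅ α ⁆ ∩ C) x ∧ (⁅ b ⁆ ∩ C) x ≡ false
  apart-∩ C x with α ≟ x
  ... | yes refl rewrite ⌊⌋-false (b ≟ α) (α≢b ∘ sym) = ∧-zeroʳ (C α)
  ... | no _ = refl
  reps⊆M : ⁅ α ⁆ ∪ ⁅ b ⁆ ⊆ M
  reps⊆M x inReps with ∨-true (⁅ α ⁆ x) inReps
  ... | inj₁ α≡x = ∧-conicalˡ (M x) _ (⁅α⁆⊆M x α≡x)
  ... | inj₂ b≡x = subst (λ y → M y ≡ true) (⁅⁆-sound b≡x) Mb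
  localColouring′ : (cp : Fin n → ℕ) → LocalColouring G M (⁅ α ⁆ ∪ ⁅ b ⁆) cp
  localColouring′ cp with cp α ℕ.≟ cp b
  ... | no α≢b-colour = LocalColouring-cong (∖⁅⁆-∪⁅⁆ M Mb)
         (addSingleton cp b (trans (cong (λ e → M b ∧ not e) (⁅⁆-refl b)) (∧-zeroʳ (M b))) ⁅α⁆⊆M
            (λ ρ α≡ρ → subst (λ y → cp y ≢ cp b) (⁅⁆-sound α≡ρ) α≢b-colour) (localColouring cp))
  ... | yes same-colour = blockColouring cp whole α (∪-introˡ ⁅ α ⁆ ⁅ b ⁆ α (⁅⁆-refl α)) reps-parity
    where
    whole : ParitySplit G M (λ _ → true)
    whole = oddEvenSplit G M
    rest-even : parity (M ∖ ParitySplit.X whole) ≡ false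
    rest-even = trans (parity-∖oddPart G (ParitySplit.X⊆S whole) (ParitySplit.X-degrees whole)) M-even
    reps-parity : ∀ γ → parity ((⁅ α ⁆ ∪ ⁅ b ⁆) ∩ colourIs cp γ) ≡ parity (M ∖ ParitySplit.X whole) ∧ ⌊ cp α ℕ.≟ γ ⌋
    reps-parity γ = begin
      parity ((⁅ α ⁆ ∪ ⁅ b ⁆) ∩ colourIs cp γ)
        ≡⟨ parity-cong (λ x → ∧-distribʳ-∨ (colourIs cp γ x) (⁅ α ⁆ x) (⁅ b ⁆ x)) ⟩
      parity ((⁅ α ⁆ ∩ colourIs cp γ) ∪ (⁅ b ⁆ ∩ colourIs cp γ))
        ≡⟨ parity-∪ (apart-∩ (colourIs cp γ)) ⟩
      parity (⁅ α ⁆ ∩ colourIs cp γ) xor parity (⁅ b ⁆ ∩ colourIs cp γ)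
        ≡⟨ cong₂ _xor_ (parity-⁅⁆∩ α (colourIs cp γ)) (parity-⁅⁆∩ b (colourIs cp γ)) ⟩
      ⌊ cp α ℕ.≟ γ ⌋ xor ⌊ cp b ℕ.≟ γ ⌋
        ≡⟨ cong (λ c → ⌊ cp α ℕ.≟ γ ⌋ xor ⌊ c ℕ.≟ γ ⌋) (sym same-colour) ⟩
      ⌊ cp α ℕ.≟ γ ⌋ xor ⌊ cp α ℕ.≟ γ ⌋
        ≡⟨ xor-same ⌊ cp α ℕ.≟ γ ⌋ ⟩
      false
        ≡⟨ cong (_∧ ⌊ cp α ℕ.≟ γ ⌋) rest-even ⟨
      parity (M ∖ ParitySplit.X whole) ∧ ⌊ cp α ℕ.≟ γ ⌋ ∎
      where open ≡-Reasoning

emptyRepresentatives : (G : Graph n) (M : VSet n) → (∀ x → M x ≡ false) → Representatives G M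
emptyRepresentatives {n = n} G M empty = record
  { reps = none
  ; reps⊆M = λ _ ()
  ; reps-count = subst (_≤ 2) (sym (count-empty {A = none} (λ _ → refl))) z≤n
  ; reps-parity = trans (parity-empty {A = none} (λ _ → refl)) (sym (parity-empty empty))
  ; reps-nonEmpty = λ { (x , Mx) → ⊥-elim (true≢false (trans (sym Mx) (empty x))) }
  ; localColouring = λ cp → record
    { colour = λ _ → 0
    ; zero-odd = λ u inM → ⊥-elim (outside u inM)
    ; suc-even = λ _ u inM → ⊥-elim (outside u inM)
    ; suc-parity = λ γ → trans (parity-empty (λ x → cong (_∧ ⌊ 0 ℕ.≟ suc γ ⌋) (empty x))) (sym (parity-empty {A = none ∩ colourIs cp γ} (λ _ → refl)))
    ; suc-rep = λ _ u inM → ⊥-elim (outside u inM)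
    }
  }
  where
  none : VSet n
  none _ = false
  outside : ∀ u {b} → M u ∧ b ≡ true → ⊥
  outside u {b} inM = true≢false (trans (sym inM) (cong (_∧ b) (empty u)))

representatives : (G : Graph n) (M : VSet n) → Representatives G M
representatives G M with search M
... | inj₂ empty = emptyRepresentatives G M empty
... | inj₁ (b , Mb) with bool-cases (parity M)
...   | inj₁ odd = oddRepresentatives G M odd
...   | inj₂ even = evenRepresentatives G M even b Mb

-- Gluing along a module partition

module Gluing (G : Graph n) (C : VSet n) (p : Fin n → Fin k) (modules : ∀ i → IsModuleIn G C (part C p i)) where

  M : Fin k → VSet n
  M = part C p

  M⊆C : ∀ i → M i ⊆ C
  M⊆C i x = ∧-conicalˡ (C x) _

  M-label : ∀ {i x} → M i x ≡ true → p x ≡ i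
  M-label {i} {x} Mx = ⌊⌋-sound (p x ≟ i) (∧-conicalʳ (C x) _ Mx)

  M-intro : ∀ {i x} → C x ≡ true → p x ≡ i → M i x ≡ true
  M-intro {i} {x} Cx refl = cong₂ _∧_ Cx (⌊⌋-true (p x ≟ p x) refl)

  M-outside : ∀ {i x} → p x ≢ i → M i x ≡ false
  M-outside {i} {x} px≢i = trans (cong (C x ∧_) (⌊⌋-false (p x ≟ i) px≢i)) (∧-zeroʳ (C x))

  adj-across : ∀ {i j u r x y} → i ≢ j → M i u ≡ true → M i r ≡ true → M j x ≡ true → M j y ≡ true → adj G u x ≡ adj G r y
  adj-across {i} {j} {u} {r} {x} {y} i≢j Mu Mr Mx My = begin
    adj G u x  ≡⟨ modules j u (M⊆C i u Mu) (M-outside λ pu≡j → i≢j (trans (sym (M-label Mu)) pu≡j)) x y Mx My ⟩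
    adj G u y  ≡⟨ adj-sym G u y ⟩
    adj G y u  ≡⟨ modules i y (M⊆C j y My) (M-outside λ py≡i → i≢j (trans (sym py≡i) (M-label My))) u r Mu Mr ⟩
    adj G y r  ≡⟨ adj-sym G y r ⟩
    adj G r y  ∎
    where open ≡-Reasoning

  Outer : Fin k → VSet n → Fin n → VSet n
  Outer i A w = ((C ∖ M i) ∩ A) ∩ adj G w

  Outer-fibre⊆ : ∀ i j A w → Outer i A w ∩ fibre p j ⊆ M j
  Outer-fibre⊆ i j A w x inFibre =
    cong₂ _∧_ (∧-conicalˡ (C x) _ (∧-conicalˡ _ _ (∧-conicalˡ _ _ (∧-conicalˡ _ _ inFibre)))) (∧-conicalʳ (Outer i A w x) _ inFibre)

  Outer-own-fibre : ∀ i A w x → (Outer i A w ∩ fibre p i) x ≡ false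
  Outer-own-fibre i A w x with bool-cases ((Outer i A w ∩ fibre p i) x)
  ... | inj₂ absent = absent
  ... | inj₁ present = ⊥-elim (true≢false (trans (sym outside-Mi) (cong not (Outer-fibre⊆ i i A w x present))))
    where
    outside-Mi : not (M i x) ≡ true
    outside-Mi = ∧-conicalʳ (C x) _ (∧-conicalˡ _ _ (∧-conicalˡ _ _ (∧-conicalˡ _ _ present)))

  Outer-fibre : ∀ {i j w r y} → j ≢ i → M i w ≡ true → M i r ≡ true → M j y ≡ true → (A : VSet n) →
                Outer i A w ∩ fibre p j ≗ (M j ∩ A) ∩ (λ _ → adj G r y)
  Outer-fibre {i} {j} {w} {r} {y} j≢i Mw Mr My A x with bool-cases (M j x)
  ... | inj₂ ¬Mjx = trans (⊆-false (Outer-fibre⊆ i j A w) x ¬Mjx) (sym (cong (λ t → (t ∧ A x) ∧ adj G r y) ¬Mjx))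
  ... | inj₁ Mjx
    rewrite M-outside {i} {x} (λ px≡i → j≢i (trans (sym (M-label Mjx)) px≡i)) | Mjx | ∧-conicalʳ (C x) _ Mjx
          | M⊆C j x Mjx | adj-across (j≢i ∘ sym) Mw Mr Mjx My = ∧-identityʳ (A x ∧ adj G r y)

  -- A vertex outside M j sees all of M j or none of it, so only the parities of the traces on the other
  -- modules matter.
  transfer : ∀ i {u r} → M i u ≡ true → M i r ≡ true → (P Q : VSet n) →
             (∀ j → j ≢ i → parity (M j ∩ P) ≡ parity (M j ∩ Q)) →
             degParity G ((C ∖ M i) ∩ P) u ≡ degParity G ((C ∖ M i) ∩ Q) r
  transfer i {u} {r} Mu Mr P Q same = begin
    parity (Outer i P u)                                   ≡⟨ parity-fibres p (Outer i P u) ⟩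
    ⊕Σ.sum (λ j → parity (Outer i P u ∩ fibre p j))        ≡⟨ ⊕Σ.sum-cong-≗ per-part ⟩
    ⊕Σ.sum (λ j → parity (Outer i Q r ∩ fibre p j))        ≡⟨ parity-fibres p (Outer i Q r) ⟨
    parity (Outer i Q r)                                   ∎
    where
    open ≡-Reasoning
    per-part : ∀ j → parity (Outer i P u ∩ fibre p j) ≡ parity (Outer i Q r ∩ fibre p j)
    per-part j with j ≟ i
    ... | yes refl = trans (parity-empty (Outer-own-fibre i P u)) (sym (parity-empty (Outer-own-fibre i Q r)))
    ... | no j≢i with search (M j)
    ...   | inj₂ empty = trans (parity-empty (λ x → ⊆-false (Outer-fibre⊆ i j P u) x (empty x)))
                               (sym (parity-empty (λ x → ⊆-false (Outer-fibre⊆ i j Q r) x (empty x))))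
    ...   | inj₁ (y , My) = begin
      parity (Outer i P u ∩ fibre p j)   ≡⟨ parity-cong (Outer-fibre j≢i Mu Mr My P) ⟩
      parity ((M j ∩ P) ∩ (λ _ → adj G r y))  ≡⟨ parity-∧ʳ (M j ∩ P) (adj G r y) ⟩
      parity (M j ∩ P) ∧ adj G r y       ≡⟨ cong (_∧ adj G r y) (same j j≢i) ⟩
      parity (M j ∩ Q) ∧ adj G r y       ≡⟨ parity-∧ʳ (M j ∩ Q) (adj G r y) ⟨
      parity ((M j ∩ Q) ∩ (λ _ → adj G r y))  ≡⟨ parity-cong (Outer-fibre j≢i Mr Mr My Q) ⟨
      parity (Outer i Q r ∩ fibre p j)   ∎

  crossGraph : Graph n
  crossGraph = record
    { adj = λ a b → adj G a b ∧ not (⁅ p a ⁆ (p b))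
    ; adj-sym = λ a b → cong₂ (λ e s → e ∧ not s) (adj-sym G a b) (⁅⁆-sym (p a) (p b))
    ; irrefl = λ a → cong (_∧ not (⁅ p a ⁆ (p a))) (irrefl G a)
    }

  reps : Fin k → VSet n
  reps i = Representatives.reps (representatives G (M i))

  reps⊆M : ∀ i → reps i ⊆ M i
  reps⊆M i = Representatives.reps⊆M (representatives G (M i))

  R : VSet n
  R x = reps (p x) x

  R-fibre : ∀ j → R ∩ fibre p j ≗ reps j
  R-fibre j x with p x ≟ j
  ... | yes refl = ∧-identityʳ (R x)
  ... | no px≢j = trans (∧-zeroʳ (R x)) (sym (⊆-false (reps⊆M j) x (M-outside px≢j)))

  R⊆C : R ⊆ C
  R⊆C x Rx = M⊆C (p x) x (reps⊆M (p x) x Rx)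

  R-even : parity C ≡ false → parity R ≡ false
  R-even C-even = begin
    parity R                                     ≡⟨ parity-fibres p R ⟩
    ⊕Σ.sum (λ j → parity (R ∩ fibre p j))        ≡⟨ ⊕Σ.sum-cong-≗ (λ j → trans (parity-cong (R-fibre j)) (Representatives.reps-parity (representatives G (M j)))) ⟩
    ⊕Σ.sum (λ j → parity (C ∩ fibre p j))        ≡⟨ parity-fibres p C ⟨
    parity C                                     ≡⟨ C-even ⟩
    false                                        ∎
    where open ≡-Reasoning

  R-count : count R ≤ k * 2
  R-count = subst (_≤ k * 2) (count-fibres p R)
    (sum-≤ (λ j → count (R ∩ fibre p j)) λ j → subst (_≤ 2) (sym (count-cong (R-fibre j))) (Representatives.reps-count (representatives G (M j))))

  reps⇒R : ∀ {i x} → reps i x ≡ true → R x ≡ true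
  reps⇒R {i} {x} inReps = subst (λ j → reps j x ≡ true) (sym (M-label (reps⊆M i x inReps))) inReps

  cross-adjacent : ∀ {v v′ r r′} → C v ≡ true → C v′ ≡ true → adj G v v′ ≡ true → p v ≢ p v′ →
                   M (p v) r ≡ true → M (p v′) r′ ≡ true → adj crossGraph r r′ ≡ true
  cross-adjacent {v} {v′} {r} {r′} Cv Cv′ e parts-differ Mr Mr′ = cong₂ _∧_
    (trans (adj-across parts-differ Mr (M-intro Cv refl) Mr′ (M-intro Cv′ refl)) e)
    (cong not (⌊⌋-false (p r ≟ p r′) λ pr≡pr′ → parts-differ (trans (sym (M-label Mr)) (trans pr≡pr′ (M-label Mr′)))))

  module Connectivity (conn : Connected G C) {x₀ y₀ : Fin n} (Cx₀ : C x₀ ≡ true) (Cy₀ : C y₀ ≡ true)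
                      (x₀≁y₀ : p x₀ ≢ p y₀) where

    representativeOf : ∀ {v} → C v ≡ true → Σ (Fin n) λ ρ → reps (p v) ρ ≡ true
    representativeOf {v} Cv = Representatives.reps-nonEmpty (representatives G (M (p v))) (v , M-intro Cv refl)

    ρ₀ : Fin n
    ρ₀ = proj₁ (representativeOf Cx₀)

    Linked : Fin n → Set
    Linked v = ∀ r → R r ≡ true → p r ≡ p v → Path crossGraph R ρ₀ r

    cross-step : ∀ {v v′ ρ} → C v ≡ true → C v′ ≡ true → adj G v v′ ≡ true → p v ≢ p v′ → reps (p v) ρ ≡ true →
                 ∀ r′ → R r′ ≡ true → p r′ ≡ p v′ → Path crossGraph R ρ r′
    cross-step {v} Cv Cv′ e differ ρ∈ r′ Rr′ pr′ =
      step (reps⇒R ρ∈) (cross-adjacent Cv Cv′ e differ (reps⊆M (p v) _ ρ∈) (M-intro (R⊆C r′ Rr′) pr′)) (here Rr′)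

    linked-step : ∀ {v v′} → C v ≡ true → C v′ ≡ true → adj G v v′ ≡ true → Linked v → Linked v′
    linked-step {v} {v′} Cv Cv′ e linked r′ Rr′ pr′ with p v ≟ p v′ | representativeOf Cv
    ... | yes same | _ = linked r′ Rr′ (trans pr′ (sym same))
    ... | no differ | ρ , ρ∈ = linked ρ (reps⇒R ρ∈) (M-label (reps⊆M (p v) ρ ρ∈)) ++ cross-step Cv Cv′ e differ ρ∈ r′ Rr′ pr′

    -- As long as the walk from x₀ stays in the part of x₀ there is nothing to link.
    linked-or-home : ∀ {v v′} → C v ≡ true → C v′ ≡ true → adj G v v′ ≡ true →
                     p v ≡ p x₀ ⊎ Linked v → p v′ ≡ p x₀ ⊎ Linked v′
    linked-or-home Cv Cv′ e (inj₂ linked) = inj₂ (linked-step Cv Cv′ e linked)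
    linked-or-home {v} {v′} Cv Cv′ e (inj₁ home) with p v′ ≟ p x₀
    ... | yes home′ = inj₁ home′
    ... | no away = inj₂ (cross-step Cv Cv′ e (λ same → away (trans (sym same) home))
                                     (subst (λ i → reps i ρ₀ ≡ true) (sym home) (proj₂ (representativeOf Cx₀))))

    linked-y₀ : Linked y₀
    linked-y₀ with transport-along {Φ = λ v → p v ≡ p x₀ ⊎ Linked v} linked-or-home (conn x₀ y₀ Cx₀ Cy₀) (inj₁ refl)
    ... | inj₁ home = ⊥-elim (x₀≁y₀ (sym home))
    ... | inj₂ linked = linked

    R-connected : Connected crossGraph R
    R-connected x y Rx Ry = reverse (from-ρ₀ x Rx) ++ from-ρ₀ y Ry
      where
      from-ρ₀ : ∀ r → R r ≡ true → Path crossGraph R ρ₀ r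
      from-ρ₀ r Rr = transport-along {Φ = Linked} linked-step (conn y₀ r Cy₀ (R⊆C r Rr)) linked-y₀ r Rr refl

  M∩R : ∀ j → M j ∩ R ≗ reps j
  M∩R j x = trans (∧-swapʳ (C x) (fibre p j x) (R x)) (trans (cong (_∧ fibre p j x) (∩-⊆ R⊆C x)) (R-fibre j x))

  inner-outer : ∀ i (X : VSet n) u → degParity G (C ∩ X) u ≡ degParity G (M i ∩ X) u xor degParity G ((C ∖ M i) ∩ X) u
  inner-outer i X u = trans (degParity-split G (C ∩ X) (M i) u)
    (cong₂ _xor_ (degParity-cong G inside u) (degParity-cong G (λ x → ∧-swapʳ (C x) (X x) (not (M i x))) u))
    where
    inside : (C ∩ X) ∩ M i ≗ M i ∩ X
    inside x = trans (∧-swapʳ (C x) (X x) (M i x)) (cong (_∧ X x) (∩-⊆ (M⊆C i) x))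

  module Glued (scottColouring : OddColouring crossGraph R) where
    open OddColouring scottColouring renaming (colour to cp; colour-< to cp-<; colour-odd to cp-odd)

    local : ∀ i → LocalColouring G (M i) (reps i) cp
    local i = Representatives.localColouring (representatives G (M i)) cp

    colour : Fin n → ℕ
    colour x = LocalColouring.colour (local (p x)) x

    layer : ∀ i t → M i ∩ colourIs colour t ≗ M i ∩ colourIs (LocalColouring.colour (local i)) t
    layer i t x with p x ≟ i
    ... | yes refl = refl
    ... | no _ = trans (cong (_∧ colourIs colour t x) (∧-zeroʳ (C x)))
                       (sym (cong (_∧ colourIs (LocalColouring.colour (local i)) t x) (∧-zeroʳ (C x))))

    in-layer : ∀ {u t} → C u ≡ true → colour u ≡ t → (M (p u) ∩ colourIs (LocalColouring.colour (local (p u))) t) u ≡ true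
    in-layer {u} {t} Cu colour-u = cong₂ _∧_ (M-intro Cu refl) (⌊⌋-true (colour u ℕ.≟ t) colour-u)

    -- Outside its own module, ρ has the same neighbours in G and in the cross graph.
    outer-at-rep : ∀ {ρ γ} → cp ρ ≡ γ →
      degParity G ((C ∖ M (p ρ)) ∩ (R ∩ colourIs cp γ)) ρ ≡ degParity crossGraph (R ∩ classOf cp ρ) ρ
    outer-at-rep {ρ} refl = parity-cong λ x →
      trans (shuffle (C x) (R x) (R⊆C x)) (cong (λ e → (R x ∧ colourIs cp (cp ρ) x) ∧ (adj G ρ x ∧ not e)) (⁅⁆-sym (p x) (p ρ)))
      where
      shuffle : ∀ c r {f k a} → (r ≡ true → c ≡ true) → ((c ∧ not (c ∧ f)) ∧ (r ∧ k)) ∧ a ≡ (r ∧ k) ∧ (a ∧ not f)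
      shuffle c false _ = trans (cong (_∧ _) (∧-zeroʳ (c ∧ _))) refl
      shuffle c true {f} {k} {a} r⇒c rewrite r⇒c refl with f | k | a
      ... | false | false | _ = refl
      ... | false | true | false = refl
      ... | false | true | true = refl
      ... | true | false | _ = refl
      ... | true | true | false = refl
      ... | true | true | true = refl

    odd-at : ∀ u t → C u ≡ true → colour u ≡ t → degParity G (C ∩ colourIs colour t) u ≡ true
    odd-at u zero Cu colour-u = begin
      degParity G (C ∩ colourIs colour 0) u
        ≡⟨ inner-outer i (colourIs colour 0) u ⟩
      degParity G (M i ∩ colourIs colour 0) u xor degParity G ((C ∖ M i) ∩ colourIs colour 0) u
        ≡⟨ cong₂ _xor_ (trans (degParity-cong G (layer i 0) u) (zero-odd u (in-layer Cu colour-u))) outer ⟩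
      true ∎
      where
      open ≡-Reasoning
      i : Fin k
      i = p u
      open LocalColouring (local i) using (zero-odd)
      Mu : M i u ≡ true
      Mu = M-intro Cu refl
      outer : degParity G ((C ∖ M i) ∩ colourIs colour 0) u ≡ false
      outer = trans (transfer i Mu Mu (colourIs colour 0) (λ _ → false) λ j _ →
                       trans (parity-cong (layer j 0))
                             (trans (oddIn⇒even G _ (LocalColouring.zero-odd (local j)))
                                    (sym (parity-empty (λ x → ∧-zeroʳ (M j x))))))
                    (parity-empty (λ x → cong (_∧ adj G u x) (∧-zeroʳ ((C ∖ M i) x))))
    odd-at u (suc γ) Cu colour-u with LocalColouring.suc-rep (local (p u)) γ u (in-layer Cu colour-u)
    ... | ρ , ρ∈ , cpρ = begin
      degParity G (C ∩ colourIs colour (suc γ)) u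
        ≡⟨ inner-outer i (colourIs colour (suc γ)) u ⟩
      degParity G (M i ∩ colourIs colour (suc γ)) u xor degParity G ((C ∖ M i) ∩ colourIs colour (suc γ)) u
        ≡⟨ cong₂ _xor_ (trans (degParity-cong G (layer i (suc γ)) u) (suc-even γ u (in-layer Cu colour-u))) outer ⟩
      true ∎
      where
      open ≡-Reasoning
      i : Fin k
      i = p u
      open LocalColouring (local i) using (suc-even)
      Mρ : M i ρ ≡ true
      Mρ = reps⊆M i ρ ρ∈
      same-parities : ∀ j → j ≢ i → parity (M j ∩ colourIs colour (suc γ)) ≡ parity (M j ∩ (R ∩ colourIs cp γ))
      same-parities j _ = trans (parity-cong (layer j (suc γ)))
        (trans (LocalColouring.suc-parity (local j) γ)
               (parity-cong λ x → trans (cong (_∧ colourIs cp γ x) (sym (M∩R j x))) (∧-assoc (M j x) (R x) _)))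
      outer : degParity G ((C ∖ M i) ∩ colourIs colour (suc γ)) u ≡ true
      outer = begin
        degParity G ((C ∖ M i) ∩ colourIs colour (suc γ)) u          ≡⟨ transfer i (M-intro Cu refl) Mρ _ _ same-parities ⟩
        degParity G ((C ∖ M i) ∩ (R ∩ colourIs cp γ)) ρ               ≡⟨ cong (λ j → degParity G ((C ∖ M j) ∩ (R ∩ colourIs cp γ)) ρ) (sym (M-label Mρ)) ⟩
        degParity G ((C ∖ M (p ρ)) ∩ (R ∩ colourIs cp γ)) ρ           ≡⟨ outer-at-rep cpρ ⟩
        degParity crossGraph (R ∩ classOf cp ρ) ρ                     ≡⟨ cp-odd ρ (reps⇒R ρ∈) ⟩
        true                                                          ∎

    colour-odd : IsOddColouringOf G C colour
    colour-odd u Cu = odd-at u (colour u) Cu refl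

    colour-≤ : ∀ u → C u ≡ true → colour u ≤ count R
    colour-≤ u Cu with colour u in colour-u
    ... | zero = z≤n
    ... | suc γ with LocalColouring.suc-rep (local (p u)) γ u (in-layer Cu colour-u)
    ...   | ρ , ρ∈ , refl = cp-< ρ (reps⇒R ρ∈)

-- Modular width, components and the theorem

record ModulePartition (G : Graph n) (m : ℕ) (C : VSet n) : Set where
  field
    parts : ℕ
    parts≤m : parts ≤ m
    label : Fin n → Fin parts
    modules : ∀ i → IsModuleIn G C (part C label i)
    x₀ y₀ : Fin n
    Cx₀ : C x₀ ≡ true
    Cy₀ : C y₀ ≡ true
    x₀≁y₀ : label x₀ ≢ label y₀

IsModuleIn-⊆ : (G : Graph n) {C S : VSet n} (p : Fin n → Fin k) → C ⊆ S →
               ∀ i → IsModuleIn G S (part S p i) → IsModuleIn G C (part C p i)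
IsModuleIn-⊆ G {C} {S} p C⊆S i module-S w Cw w∉ x y x∈ y∈ =
  module-S w (C⊆S w Cw) (trans (cong (_∧ ⌊ p w ≟ i ⌋) (C⊆S w Cw)) (trans (cong (_∧ ⌊ p w ≟ i ⌋) (sym Cw)) w∉))
           x y (within x x∈) (within y y∈)
  where
  within : part C p i ⊆ part S p i
  within z z∈ = cong₂ _∧_ (C⊆S z (∧-conicalˡ (C z) _ z∈)) (∧-conicalʳ (C z) _ z∈)

-- Follow the modular decomposition down to the first module partition that separates two vertices of C.
separatingPartition : {G : Graph n} {m : ℕ} {S C : VSet n} → MWAtMost G m S → C ⊆ S →
                      C a ≡ true → C b ≡ true → a ≢ b → ModulePartition G m C
separatingPartition (single v Sv unique _) C⊆S Ca Cb a≢b = ⊥-elim (a≢b (trans (unique _ (C⊆S _ Ca)) (sym (unique _ (C⊆S _ Cb)))))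
separatingPartition {a = a} {G = G} {S = S} {C = C} (split k k≤m p _ modules-S recursive) C⊆S Ca Cb a≢b
  with search (λ z → C z ∧ not (⁅ p a ⁆ (p z)))
... | inj₁ (z , separated) = record
  { parts = k
  ; parts≤m = k≤m
  ; label = p
  ; modules = λ i → IsModuleIn-⊆ G p C⊆S i (modules-S i)
  ; x₀ = a
  ; y₀ = z
  ; Cx₀ = Ca
  ; Cy₀ = ∧-conicalˡ (C z) _ separated
  ; x₀≁y₀ = λ pa≡pz → true≢false (trans (sym (∧-conicalʳ (C z) _ separated)) (cong not (⌊⌋-true (p a ≟ p z) pa≡pz)))
  }
... | inj₂ unseparated = separatingPartition (recursive (p a) (a , in-part a Ca)) in-part Ca Cb a≢b
  where
  in-part : C ⊆ part S p (p a)
  in-part x Cx = cong₂ _∧_ (C⊆S x Cx) (trans (⌊⌋-cong sym sym (p x ≟ p a) (p a ≟ p x)) (∧-not-false Cx (unseparated x)))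

colour-budget : ∀ {k m} → 0 < k → k ≤ m → suc (k * 2) ≤ 3 * m
colour-budget {k} {m} 0<k k≤m = begin
  suc (k * 2)         ≤⟨ s≤s (*-monoˡ-≤ 2 k≤m) ⟩
  suc (m * 2)         ≡⟨ cong suc (*-comm m 2) ⟩
  1 + (m + (m + 0))   ≤⟨ +-monoˡ-≤ (m + (m + 0)) (≤-trans 0<k k≤m) ⟩
  m + (m + (m + 0))   ∎
  where open ≤-Reasoning

componentColouring : {G : Graph n} {m : ℕ} {C : VSet n} → Connected G C → parity C ≡ false → ModulePartition G m C →
  Σ (Fin n → ℕ) λ c → (∀ u → C u ≡ true → c u < 3 * m) × IsOddColouringOf G C c
componentColouring {n = n} {G = G} {m = m} {C = C} conn C-even partition = colour , colour-< , colour-odd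
  where
  open ModulePartition partition
  open Gluing G C label modules
  open Connectivity conn Cx₀ Cy₀ x₀≁y₀
  open Glued (scott {G = crossGraph} n R (count-≤ R) R-connected (R-even C-even))
  colour-< : ∀ u → C u ≡ true → colour u < 3 * m
  colour-< u Cu = ≤-trans (s≤s (≤-trans (colour-≤ u Cu) R-count)) (colour-budget (nonEmpty (label x₀)) parts≤m)
    where
    nonEmpty : ∀ {k} → Fin k → 0 < k
    nonEmpty {suc _} _ = s≤s z≤n

listSet : List (Fin n) → VSet n
listSet [] _ = false
listSet (x ∷ xs) = ⁅ x ⁆ ∪ listSet xs

listSet-sound : ∀ (xs : List (Fin n)) {u} → listSet xs u ≡ true → u ∈ xs
listSet-sound (x ∷ xs) {u} u∈ with ∨-true (⁅ x ⁆ u) u∈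
... | inj₁ x≡u = here (sym (⁅⁆-sound x≡u))
... | inj₂ u∈xs = there (listSet-sound xs u∈xs)

listSet-complete : ∀ {xs : List (Fin n)} {u} → u ∈ xs → listSet xs u ≡ true
listSet-complete {xs = x ∷ xs} (here refl) = ∪-introˡ ⁅ x ⁆ (listSet xs) x (⁅⁆-refl x)
listSet-complete {xs = x ∷ xs} (there u∈xs) = ∪-introʳ ⁅ x ⁆ (listSet xs) _ (listSet-complete u∈xs)

listSet-∉ : ∀ {x : Fin n} {xs} → All (x ≢_) xs → listSet xs x ≡ false
listSet-∉ [] = refl
listSet-∉ {x = x} {y ∷ _} (x≢y ∷ x∉) = cong₂ _∨_ (⌊⌋-false (y ≟ x) (x≢y ∘ sym)) (listSet-∉ x∉)

count-listSet : ∀ (xs : List (Fin n)) → Unique xs → count (listSet xs) ≡ length xs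
count-listSet {n} [] _ = count-empty {A = listSet {n} []} (λ _ → refl)
count-listSet (x ∷ xs) (x∉xs ∷ unique) =
  trans (count-∪ disjoint) (cong₂ _+_ (count-⁅⁆ x) (count-listSet xs unique))
  where
  disjoint : ∀ u → ⁅ x ⁆ u ∧ listSet xs u ≡ false
  disjoint u with x ≟ u
  ... | yes refl = listSet-∉ x∉xs
  ... | no _ = refl

reach-++ : Reach G a b → Reach G b c → Reach G a c
reach-++ here q = q
reach-++ (step e p) q = step e (reach-++ p q)

reach-reverse : Reach G a b → Reach G b a
reach-reverse here = here
reach-reverse {G = G} (step {u} {v} e p) = reach-++ (reach-reverse p) (step (trans (adj-sym G v u) e) here)

first : VSet n → Maybe (Fin n)
first {zero} _ = nothing
first {suc n} A = if A zero then just zero else Maybe.map suc (first (A ∘ suc))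

first-cong : {A B : VSet n} → A ≗ B → first A ≡ first B
first-cong {zero} _ = refl
first-cong {suc n} {A} {B} A≗B rewrite A≗B zero | first-cong {A = A ∘ suc} {B ∘ suc} (A≗B ∘ suc) = refl

first-found : (A : VSet n) → A a ≡ true → Σ (Fin n) λ y → first A ≡ just y × A y ≡ true
first-found {suc n} {a} A Aa with A zero in A0
... | true = zero , refl , A0
... | false with a
...   | zero with () ← trans (sym Aa) A0
...   | suc a′ with first-found (A ∘ suc) Aa
...     | y , first≡y , Ay rewrite first≡y = suc y , refl , Ay

module Components (G : Graph n) (even-components : AllComponentsEven G) where

  comp : Fin n → VSet n
  comp v = listSet (proj₁ (even-components v))

  comp⇒Reach : ∀ {v u} → comp v u ≡ true → Reach G v u
  comp⇒Reach {v} {u} inComp = Equivalence.to (proj₁ (proj₂ (proj₂ (even-components v))) u) (listSet-sound _ inComp)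

  Reach⇒comp : ∀ {v u} → Reach G v u → comp v u ≡ true
  Reach⇒comp {v} {u} v⇝u = listSet-complete (Equivalence.from (proj₁ (proj₂ (proj₂ (even-components v))) u) v⇝u)

  comp-even : ∀ v → parity (comp v) ≡ false
  comp-even v with even-components v
  ... | xs , unique , _ , even =
    trans (parity≡isOdd-count (listSet xs)) (trans (cong isOdd (count-listSet xs unique)) (Even⇒¬isOdd (length xs) even))

  comp-connected : ∀ v → Connected G (comp v)
  comp-connected v x y vx vy = reverse (path-from-v (comp⇒Reach vx) here) ++ path-from-v (comp⇒Reach vy) here
    where
    path-from-v : ∀ {a b} → Reach G a b → Reach G v a → Path G (comp v) a b
    path-from-v here v⇝a = here (Reach⇒comp v⇝a)
    path-from-v (step e a⇝b) v⇝a = step (Reach⇒comp v⇝a) e (path-from-v a⇝b (reach-++ v⇝a (step e here)))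

  comp-cong : ∀ {v w} → Reach G v w → comp w ≗ comp v
  comp-cong v⇝w u = bool-ext (λ wu → Reach⇒comp (reach-++ v⇝w (comp⇒Reach wu)))
                             (λ vu → Reach⇒comp (reach-++ (reach-reverse v⇝w) (comp⇒Reach vu)))

  -- A canonical vertex of each component, so that colourings chosen per component agree across it.
  leader : Fin n → Fin n
  leader v = fromMaybe v (first (comp v))

  leader-first : ∀ v → Σ (Fin n) λ y → first (comp v) ≡ just y × leader v ≡ y × comp v y ≡ true
  leader-first v with first-found (comp v) (Reach⇒comp here)
  ... | y , first≡y , vy rewrite first≡y = y , refl , refl , vy

  leader-cong : ∀ {v w} → Reach G v w → leader w ≡ leader v
  leader-cong {v} {w} v⇝w with leader-first v
  ... | y , first≡y , leader≡y , _ rewrite first-cong (comp-cong v⇝w) | first≡y = sym leader≡y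

  in-leader-comp : ∀ v → comp (leader v) v ≡ true
  in-leader-comp v with leader-first v
  ... | y , _ , leader≡y , vy rewrite leader≡y = Reach⇒comp (reach-reverse (comp⇒Reach vy))

length-filter-tabulate : (P : VSet k) (f : Fin n → Fin k) → length (filterᵇ P (tabulate f)) ≡ count (P ∘ f)
length-filter-tabulate {n = zero} P f = refl
length-filter-tabulate {n = suc n} P f with P (f zero)
... | true = cong suc (length-filter-tabulate P (f ∘ suc))
... | false = length-filter-tabulate P (f ∘ suc)

oddColourable : (G : Graph n) (c : Fin n → ℕ) {K : ℕ} → (∀ v → c v < K) →
                (∀ v → degParity G (classOf c v) v ≡ true) → OddColourable G K
oddColourable {n} G c {K} c< odd = finite , λ v → isOdd⇒Odd (degInClass G finite v) (begin
  isOdd (degInClass G finite v)                       ≡⟨ cong isOdd (length-filter-tabulate (sameIn v) (λ u → u)) ⟩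
  isOdd (count (sameIn v))                            ≡⟨ parity≡isOdd-count (sameIn v) ⟨
  parity (sameIn v)                                   ≡⟨ parity-cong (λ u → cong (_∧ adj G v u) (same-colour u v)) ⟩
  degParity G (classOf c v) v                         ≡⟨ odd v ⟩
  true                                                ∎)
  where
  open ≡-Reasoning
  finite : Fin n → Fin K
  finite v = fromℕ< (c< v)
  sameIn : Fin n → VSet n
  sameIn v u = sameColour finite u v ∧ adj G v u
  same-colour : ∀ u v → sameColour finite u v ≡ classOf c v u
  same-colour u v = ⌊⌋-cong (fromℕ<-injective (c u) (c v) (c< u) (c< v)) (λ eq → fromℕ<-cong (c u) (c v) eq (c< u) (c< v))
                            (finite u ≟ finite v) (c u ℕ.≟ c v)

module EvenComponentsColouring (G : Graph n) (even-components : AllComponentsEven G) (m : ℕ)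
                               (width : ModularWidthAtMost G m) where
  open Components G even-components

  second-vertex : ∀ r → Σ (Fin n) λ s → comp r s ≡ true × r ≢ s
  second-vertex r with odd⇒nonEmpty (comp r ∖ ⁅ r ⁆) (trans (parity-∖⁅⁆ (comp r) r) (cong₂ _xor_ (comp-even r) (Reach⇒comp here)))
  ... | s , s∈ = s , ∧-conicalˡ (comp r s) _ s∈
                   , λ r≡s → true≢false (trans (sym (∧-conicalʳ (comp r s) _ s∈)) (cong not (⌊⌋-true (r ≟ s) r≡s)))

  opaque
    componentColour : ∀ r → Σ (Fin n → ℕ) λ c → (∀ u → comp r u ≡ true → c u < 3 * m) × IsOddColouringOf G (comp r) c
    componentColour r = componentColouring (comp-connected r) (comp-even r)
      (separatingPartition width (λ _ _ → refl) (Reach⇒comp here) (proj₁ (proj₂ (second-vertex r))) (proj₂ (proj₂ (second-vertex r))))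

  colour : Fin n → ℕ
  colour v = proj₁ (componentColour (leader v)) v

  colour-< : ∀ v → colour v < 3 * m
  colour-< v = proj₁ (proj₂ (componentColour (leader v))) v (in-leader-comp v)

  colour-odd : ∀ v → degParity G (classOf colour v) v ≡ true
  colour-odd v = trans (parity-cong same-neighbours) (proj₂ (proj₂ (componentColour (leader v))) v (in-leader-comp v))
    where
    c′ : Fin n → ℕ
    c′ = proj₁ (componentColour (leader v))
    same-neighbours : classOf colour v ∩ adj G v ≗ (comp (leader v) ∩ classOf c′ v) ∩ adj G v
    same-neighbours u with bool-cases (adj G v u)
    ... | inj₂ ¬vu = trans (cong (classOf colour v u ∧_) ¬vu) (trans (∧-zeroʳ _) (sym (trans (cong ((comp (leader v) ∩ classOf c′ v) u ∧_) ¬vu) (∧-zeroʳ _))))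
    ... | inj₁ vu rewrite leader-cong (step vu here) | Reach⇒comp (reach-++ (comp⇒Reach (in-leader-comp v)) (step vu here)) = refl

theorem14 : ∀ (n : ℕ) (G : Graph n) → AllComponentsEven G →
    ∀ (m : ℕ) → ModularWidthAtMost G m → OddColourable G (3 * m)
theorem14 n G even-components m width = oddColourable G colour colour-< colour-odd
  where open EvenComponentsColouring G even-components m width
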